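{- Let $q$ be a prime power and let $\mathcal W(5,q)$ be the symplectic polar space of ${\rm PG}(5,q)$ defined by the alternating form with Gram matrix $\begin{pmatrix}0_3 & I_3\\ -I_3 & 0_3\end{pmatrix}$, with symplectic polarity $\perp$. Let $\Pi_1=\langle U_4,U_5,U_6\rangle$ and $\Pi_2=\langle U_1,U_2,U_3\rangle$. For every point $P\in\Pi_2$ choose a $3$-space $\Sigma_P\subseteq P^\perp$ with $P\notin\Sigma_P$; then $\perp$ induces on $\Sigma_P$ a non-degenerate symplectic polar space $\mathcal W_P$, and $r_P=\Sigma_P\cap\Pi_1$, $t_P=\Sigma_P\cap\Pi_2$ are lines of $\mathcal W_P$. Choose a line-spread $\mathcal F_P$ of $\mathcal W_P$ containing $r_P$ and $t_P$, and let $\mathcal X_P$ be the set of the $q^2-1$ planes $\langle P,\ell\rangle$ with $\ell\in\mathcal F_P\setminus\{r_P,t_P\}$. Let $\mathcal X=\bigcup_{P\in\Pi_2}\mathcal X_P\cup\{\Pi_2\}$. Then $\mathcal X$ consists of $(q+1)(q^3-1)+1$ planes of $\mathcal W(5,q)$ (generators) disjoint from $\Pi_1$ and pairwise intersecting in at most one point.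
   Context: $U_i$ denotes the point of ${\rm PG}(5,q)$ with $1$ in position $i$ and $0$ elsewhere. A line-spread of $\mathcal W_P$ is a set of pairwise disjoint totally isotropic lines of $\mathcal W_P$ partitioning the points of $\Sigma_P$ (it has $q^2+1$ lines). -}

module Defs where

open import Level using (0ℓ)
open import Data.Nat using (ℕ; zero; suc)
open import Data.Fin using (Fin; zero; suc; _↑ˡ_; _↑ʳ_)
import Data.Fin as Fin
open import Data.Bool using (if_then_else_)
open import Relation.Nullary.Decidable using (⌊_⌋)
open import Data.Product using (Σ; ∃; ∃-syntax; _×_; _,_)
open import Data.Sum using (_⊎_)
open import Data.Unit using (⊤)
open import Relation.Nullary using (¬_)
open import Relation.Binary.PropositionalEquality using (_≡_; _≢_)
open import Relation.Binary.Definitions using (DecidableEquality)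
open import Algebra.Structures using (IsCommutativeRing)
open import Function.Bundles using (_↔_)

-- Since every finite field has prime-power order and every prime power
-- occurs, quantifying over all such records is "q a prime power, GF(q)".
record FiniteField : Set₁ where
  field
    Carrier : Set
    _+_ _*_ : Carrier → Carrier → Carrier
    -_      : Carrier → Carrier
    0# 1#   : Carrier
    isCommutativeRing : IsCommutativeRing _≡_ _+_ _*_ -_ 0# 1#
    0≢1     : 0# ≢ 1#
    inverse : ∀ x → x ≢ 0# → ∃[ y ] (x * y ≡ 1#)
    _≟_     : DecidableEquality Carrier
    q       : ℕ
    enum    : Fin q ↔ Carrier

module Geometry (F : FiniteField) where
  open FiniteField F

  V : Set
  V = Fin 6 → Carrier

  ∑ : ∀ {k} → (Fin k → Carrier) → Carrier
  ∑ {zero}  f = 0#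
  ∑ {suc k} f = f zero + ∑ (λ i → f (suc i))

  IsZero : V → Set
  IsZero v = ∀ j → v j ≡ 0#

  NonZero : V → Set
  NonZero v = ¬ IsZero v

  _∈⟨_⟩ : ∀ {k} → V → (Fin k → V) → Set
  _∈⟨_⟩ {k} v b = Σ (Fin k → Carrier) λ c → (∀ j → v j ≡ ∑ (λ i → c i * b i j))

  LinIndep : ∀ {k} → (Fin k → V) → Set
  LinIndep {k} b = ∀ (c : Fin k → Carrier) → (∀ j → ∑ (λ i → c i * b i j) ≡ 0#) → ∀ i → c i ≡ 0#

  SameSpan : ∀ {k l} → (Fin k → V) → (Fin l → V) → Set
  SameSpan b b' = ∀ v → ((v ∈⟨ b ⟩ → v ∈⟨ b' ⟩) × (v ∈⟨ b' ⟩ → v ∈⟨ b ⟩))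

  SpanIs : ∀ {k} → (Fin k → V) → (V → Set) → Set
  SpanIs b S = ∀ v → ((v ∈⟨ b ⟩ → S v) × (S v → v ∈⟨ b ⟩))

  Bf : V → V → Carrier
  Bf x y = ∑ (λ (i : Fin 3) → (x (i ↑ˡ 3) * y (3 ↑ʳ i)) + (- (x (3 ↑ʳ i) * y (i ↑ˡ 3))))

  TotIsotropic : ∀ {k} → (Fin k → V) → Set
  TotIsotropic b = ∀ i j → Bf (b i) (b j) ≡ 0#

  InΠ₁ : V → Set
  InΠ₁ v = ∀ (i : Fin 3) → v (i ↑ˡ 3) ≡ 0#

  InΠ₂ : V → Set
  InΠ₂ v = ∀ (i : Fin 3) → v (3 ↑ʳ i) ≡ 0#

  -- U_i : the point with 1 in position i and 0 elsewhere (i = 0..5 here)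
  U : Fin 6 → V
  U k j = if ⌊ k Fin.≟ j ⌋ then 1# else 0#

  Π₂basis : Fin 3 → V
  Π₂basis i = U (i ↑ˡ 3)

  -- Points of Π₂, given by their normalised representative
  -- (first non-zero coordinate equal to 1): (1,a,b,0,0,0), (0,1,a,0,0,0), (0,0,1,0,0,0).
  data Pt2 : Set where
    pt-a : Carrier → Carrier → Pt2
    pt-b : Carrier → Pt2
    pt-c : Pt2

  coords3 : Carrier → Carrier → Carrier → V
  coords3 x y z zero = x
  coords3 x y z (suc zero) = y
  coords3 x y z (suc (suc zero)) = z
  coords3 x y z (suc (suc (suc _))) = 0#

  pvec : Pt2 → V
  pvec (pt-a a b) = coords3 1# a b
  pvec (pt-b a)   = coords3 0# 1# a
  pvec pt-c       = coords3 0# 0# 1#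

  rSet : (Fin 4 → V) → V → Set
  rSet s v = v ∈⟨ s ⟩ × InΠ₁ v

  tSet : (Fin 4 → V) → V → Set
  tSet s v = v ∈⟨ s ⟩ × InΠ₂ v

  GoodSolid : V → (Fin 4 → V) → Set
  GoodSolid p s = LinIndep s × (∀ i → Bf p (s i) ≡ 0#) × ¬ (p ∈⟨ s ⟩)

  IsLineSpread : (Fin 4 → V) → ∀ {m} → (Fin m → (Fin 2 → V)) → Set
  IsLineSpread s {m} L =
      (∀ k → LinIndep (L k))
    × (∀ k i → L k i ∈⟨ s ⟩)
    × (∀ k → TotIsotropic (L k))
    × (∀ k k' → k ≢ k' → ∀ v → v ∈⟨ L k ⟩ → v ∈⟨ L k' ⟩ → IsZero v)
    × (∀ v → v ∈⟨ s ⟩ → NonZero v → ∃[ k ] (v ∈⟨ L k ⟩))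

  joinPL : V → (Fin 2 → V) → (Fin 3 → V)
  joinPL p ℓ zero = p
  joinPL p ℓ (suc zero) = ℓ zero
  joinPL p ℓ (suc (suc zero)) = ℓ (suc zero)

  MeetInAtMostAPoint : ∀ {k l} → (Fin k → V) → (Fin l → V) → Set
  MeetInAtMostAPoint b b' = ∀ v w → v ∈⟨ b ⟩ → v ∈⟨ b' ⟩ → w ∈⟨ b ⟩ → w ∈⟨ b' ⟩
    → NonZero v → NonZero w → ∃[ c ] (∀ j → v j ≡ c * w j)

  IsGenerator : (Fin 3 → V) → Set
  IsGenerator b = LinIndep b × TotIsotropic b

  DisjointFromΠ₁ : ∀ {k} → (Fin k → V) → Set
  DisjointFromΠ₁ b = ∀ v → v ∈⟨ b ⟩ → InΠ₁ v → IsZero v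

  module Construction (S : Pt2 → Fin 4 → V) (m : Pt2 → ℕ)
                      (L : (P : Pt2) → Fin (m P) → Fin 2 → V) where

    -- index set of 𝒳 (with repetitions a priori): Π₂, or (P, ℓ) with ℓ ∈ F_P ∖ {r_P, t_P}
    XIndex : Set
    XIndex = ⊤ ⊎ (Σ Pt2 λ P → Σ (Fin (m P)) λ k →
                     ¬ SpanIs (L P k) (rSet (S P)) × ¬ SpanIs (L P k) (tSet (S P)))

    plane : XIndex → Fin 3 → V
    plane (Data.Sum.inj₁ _) = Π₂basis
    plane (Data.Sum.inj₂ (P , k , _)) = joinPL (pvec P) (L P k)

module Submission where

-- A plane ⟨P, ℓ⟩ is totally isotropic because ℓ ⊆ Σ_P ⊆ P^⊥, and it is a plane because P ∉ Σ_P.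
-- Two planes through the same P meet only in P, since ⟨P, ℓ⟩ ∩ Σ_P = ℓ and the lines of a spread
-- are disjoint.  If ℓ ≠ t_P then ⟨P, ℓ⟩ ∩ Π₂ = P, and if ℓ ≠ r_P then ⟨P, ℓ⟩ misses Π₁, because
-- P^⊥ ∩ Π₁ is the line r_P.  For planes through distinct points P, P′ the Π₁-components of two
-- common vectors are orthogonal to both P and P′, hence dependent, and the corresponding combination
-- lies in Π₂ ∩ ⟨P, ℓ⟩ ∩ ⟨P′, ℓ′⟩ = 0.  Counting the q⁴ vectors of Σ_P along a spread shows that it
-- has q² + 1 lines, so 𝒳 consists of 1 + (q² + q + 1)(q² − 1) planes.

open import Defs
open import Algebra.Bundles using (CommutativeRing; RawRing; Ring)
open import Algebra.Structures using (IsCommutativeRing)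
import Algebra.Solver.Ring.AlmostCommutativeRing as ACR
open import Data.Empty using (⊥-elim)
import Data.Empty.Irrelevant as Irrelevant
open import Data.Fin using (Fin; zero; suc; _↑ˡ_; _↑ʳ_; punchIn; punchOut)
import Data.Fin as Fin
open import Data.Fin.Patterns using (0F; 1F; 2F; 3F; 4F; 5F)
open import Data.Fin.Permutation using (↔⇒≡)
open import Data.Fin.Properties
  using (¬∀⟶∃¬; all?; +↔⊎; *↔×; 1↔⊤; punchInᵢ≢i; punchIn-injective; punchIn-punchOut)
open import Data.Maybe using (Maybe; nothing; just)
open import Data.Nat using (ℕ; zero; suc)
import Data.Nat as ℕ
import Data.Nat.Properties as ℕₚ
open import Data.Product using (Σ; ∃-syntax; _×_; _,_; proj₁; proj₂)
open import Data.Product.Function.NonDependent.Propositional using (_×-↔_)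
open import Data.Sum using (_⊎_; inj₁; inj₂; [_,_]′)
open import Data.Sum.Algebra using (⊎-assoc; ⊎-comm)
open import Data.Sum.Function.Propositional using (_⊎-↔_)
open import Data.Unit using (⊤; tt)
open import Data.Vec.N-ary using (N-ary)
open import Function using (_∘_)
open import Function.Bundles using (_↔_; Inverse; Injection; mk↔ₛ′)
open import Function.Properties.Inverse using (↔-refl; ↔-sym; ↔-trans; ↔⇒↣)
open import Function.Related.Propositional using (module EquationalReasoning)
open import Level using (0ℓ)
open import Relation.Binary.PropositionalEquality
open import Relation.Nullary using (¬_; Dec; yes; no)
open import Relation.Nullary.Decidable using (_×-dec_)

-- The carrier is abstract, so the solver takes its coefficients in ℕ × ℕ, read as formal
-- differences m - n: then normal forms compute, and identities are closed by refl.
module CommutativeRingSolver {A : Set} {add mul : A → A → A} {neg : A → A} {zero one : A}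
         (isCommutativeRing : IsCommutativeRing _≡_ add mul neg zero one) where

  commutativeRing : CommutativeRing _ _
  commutativeRing = record { isCommutativeRing = isCommutativeRing }

  open CommutativeRing commutativeRing
    using ( _+_; _*_; -_; _-_; 0#; 1#; +-comm; +-identityʳ; -‿inverseʳ; distribˡ; distribʳ
          ; +-abelianGroup; +-group; +-monoid; +-commutativeSemigroup; semiring; ring )
  open import Algebra.Properties.AbelianGroup +-abelianGroup using (⁻¹-∙-comm)
  open import Algebra.Properties.CommutativeSemigroup +-commutativeSemigroup using (interchange)
  open import Algebra.Properties.Group +-group using (⁻¹-involutive; ε⁻¹≈ε)
  open import Algebra.Properties.RingWithoutOne (Ring.ringWithoutOne ring) using (-‿distribˡ-*; -‿distribʳ-*)
  open import Algebra.Properties.Monoid.Mult +-monoid using (×-homo-+) renaming (_×_ to _times_)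
  open import Algebra.Properties.Semiring.Mult semiring using (×1-homo-*)
  open ≡-Reasoning

  differences : RawRing _ _
  differences = record
    { Carrier = ℕ × ℕ ; _≈_ = _≡_
    ; _+_ = λ { (a , b) (c , d) → (a ℕ.+ c , b ℕ.+ d) }
    ; _*_ = λ { (a , b) (c , d) → (a ℕ.* c ℕ.+ b ℕ.* d , a ℕ.* d ℕ.+ b ℕ.* c) }
    ; -_ = λ { (a , b) → (b , a) }
    ; 0# = (0 , 0) ; 1# = (1 , 0) }

  nat : ℕ → A
  nat n = n times 1#

  difference : ℕ × ℕ → A
  difference (a , b) = nat a - nat b

  -- The special cases make the solver constants 0 and 1 denote 0# and 1# definitionally.
  ⟦_⟧ : ℕ × ℕ → A
  ⟦ 0 , 0 ⟧ = 0#
  ⟦ 1 , 0 ⟧ = 1#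
  ⟦ x ⟧ = difference x

  ⟦⟧≡difference : ∀ x → ⟦ x ⟧ ≡ difference x
  ⟦⟧≡difference (0 , 0) = sym (trans (cong (0# +_) ε⁻¹≈ε) (+-identityʳ 0#))
  ⟦⟧≡difference (1 , 0) = sym (trans (cong₂ _+_ (+-identityʳ 1#) ε⁻¹≈ε) (+-identityʳ 1#))
  ⟦⟧≡difference (0 , suc b) = refl
  ⟦⟧≡difference (1 , suc b) = refl
  ⟦⟧≡difference (suc (suc a) , b) = refl

  -‿homo-+ : ∀ x y → - (x + y) ≡ - x + - y
  -‿homo-+ x y = sym (⁻¹-∙-comm x y)

  [x-y][z-w] : ∀ x y z w → (x - y) * (z - w) ≡ (x * z + y * w) - (x * w + y * z)
  [x-y][z-w] x y z w = begin
    (x - y) * (z - w)                                ≡⟨ distribʳ _ _ _ ⟩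
    x * (z - w) + (- y) * (z - w)                    ≡⟨ cong₂ _+_ (distribˡ x z (- w)) (distribˡ (- y) z (- w)) ⟩
    (x * z + x * - w) + ((- y) * z + (- y) * (- w))  ≡⟨ cong₂ (λ u v → (x * z + u) + v)
                                                          (sym (-‿distribʳ-* x w))
                                                          (cong₂ _+_ (sym (-‿distribˡ-* y z)) -y*-w≡y*w) ⟩
    (x * z - x * w) + (- (y * z) + y * w)            ≡⟨ cong ((x * z - x * w) +_) (+-comm _ _) ⟩
    (x * z - x * w) + (y * w - y * z)                ≡⟨ interchange _ _ _ _ ⟩
    (x * z + y * w) + (- (x * w) + - (y * z))        ≡⟨ cong ((x * z + y * w) +_) (sym (-‿homo-+ _ _)) ⟩
    (x * z + y * w) - (x * w + y * z)                ∎
    where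
    -y*-w≡y*w : (- y) * (- w) ≡ y * w
    -y*-w≡y*w = trans (sym (-‿distribˡ-* y (- w))) (trans (cong -_ (sym (-‿distribʳ-* y w))) (⁻¹-involutive _))

  x-y≡[x+z]-[y+z] : ∀ x y z → x - y ≡ (x + z) - (y + z)
  x-y≡[x+z]-[y+z] x y z = begin
    x - y                  ≡⟨ sym (+-identityʳ _) ⟩
    (x - y) + 0#           ≡⟨ cong ((x - y) +_) (sym (-‿inverseʳ z)) ⟩
    (x - y) + (z - z)      ≡⟨ interchange _ _ _ _ ⟩
    (x + z) + (- y + - z)  ≡⟨ cong ((x + z) +_) (sym (-‿homo-+ y z)) ⟩
    (x + z) - (y + z)      ∎

  difference-+ : ∀ x y → difference (RawRing._+_ differences x y) ≡ difference x + difference y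
  difference-+ (a , b) (c , d) = trans (cong₂ _-_ (×-homo-+ 1# a c) (×-homo-+ 1# b d))
    (trans (cong ((nat a + nat c) +_) (-‿homo-+ _ _)) (interchange _ _ _ _))

  difference-* : ∀ x y → difference (RawRing._*_ differences x y) ≡ difference x * difference y
  difference-* (a , b) (c , d) = trans (cong₂ _-_
      (trans (×-homo-+ 1# (a ℕ.* c) (b ℕ.* d)) (cong₂ _+_ (×1-homo-* a c) (×1-homo-* b d)))
      (trans (×-homo-+ 1# (a ℕ.* d) (b ℕ.* c)) (cong₂ _+_ (×1-homo-* a d) (×1-homo-* b c))))
    (sym ([x-y][z-w] _ _ _ _))

  difference-neg : ∀ x → difference (RawRing.-_ differences x) ≡ - difference x
  difference-neg (a , b) = trans (+-comm _ _) (trans (cong (- nat a +_) (sym (⁻¹-involutive _))) (sym (-‿homo-+ _ _)))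

  almostCommutativeRing : ACR.AlmostCommutativeRing _ _
  almostCommutativeRing = ACR.fromCommutativeRing commutativeRing

  ⟦⟧-homo₂ : ∀ (_∙_ : A → A → A) z x y → difference z ≡ difference x ∙ difference y →
             ⟦ z ⟧ ≡ ⟦ x ⟧ ∙ ⟦ y ⟧
  ⟦⟧-homo₂ _∙_ z x y e =
    trans (⟦⟧≡difference z) (trans e (sym (cong₂ _∙_ (⟦⟧≡difference x) (⟦⟧≡difference y))))

  morphism : differences ACR.-Raw-AlmostCommutative⟶ almostCommutativeRing
  morphism = record
    { ⟦_⟧ = ⟦_⟧
    ; +-homo = λ x y → ⟦⟧-homo₂ _+_ (RawRing._+_ differences x y) x y (difference-+ x y)
    ; *-homo = λ x y → ⟦⟧-homo₂ _*_ (RawRing._*_ differences x y) x y (difference-* x y)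
    ; -‿homo = λ x → trans (⟦⟧≡difference (RawRing.-_ differences x))
                       (trans (difference-neg x) (cong -_ (sym (⟦⟧≡difference x))))
    ; 0-homo = refl
    ; 1-homo = refl
    }

  equal? : ∀ x y → Maybe (⟦ x ⟧ ≡ ⟦ y ⟧)
  equal? (a , b) (c , d) with a ℕ.+ d ℕₚ.≟ c ℕ.+ b
  ... | no _ = nothing
  ... | yes a+d≡c+b = just (trans (⟦⟧≡difference (a , b)) (trans (begin
    nat a - nat b                      ≡⟨ x-y≡[x+z]-[y+z] _ _ (nat d) ⟩
    (nat a + nat d) - (nat b + nat d)  ≡⟨ cong₂ _-_ (trans (sym (×-homo-+ 1# a d)) (trans (cong nat a+d≡c+b) (×-homo-+ 1# c b)))
                                                    (+-comm _ _) ⟩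
    (nat c + nat b) - (nat d + nat b)  ≡⟨ sym (x-y≡[x+z]-[y+z] _ _ (nat b)) ⟩
    nat c - nat d                      ∎) (sym (⟦⟧≡difference (c , d)))))

  open import Algebra.Solver.Ring differences almostCommutativeRing morphism equal? public
    using (Polynomial; solve; _:=_; _:+_; _:-_; _:*_; :-_; con)

-- Instantiated both at the field and at the
-- solver's polynomial syntax, so that each vector identity is written once and checked coordinatewise.
module Vector₃ {A : Set} (add mul : A → A → A) (neg : A → A) (zero one : A) where
  infixl 7 _*_
  infixl 6 _+_ _-_

  _+_ _*_ _-_ : A → A → A
  _+_ = add
  _*_ = mul
  x - y = x + neg y

  vec : A → A → A → Fin 3 → A
  vec a b c 0F = a
  vec a b c 1F = b
  vec a b c 2F = c

  _·_ : (Fin 3 → A) → (Fin 3 → A) → A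
  u · w = add (u 0F * w 0F) (add (u 1F * w 1F) (add (u 2F * w 2F) zero))

  _⨯_ : (Fin 3 → A) → (Fin 3 → A) → Fin 3 → A
  (u ⨯ w) 0F = u 1F * w 2F - u 2F * w 1F
  (u ⨯ w) 1F = u 2F * w 0F - u 0F * w 2F
  (u ⨯ w) 2F = u 0F * w 1F - u 1F * w 0F

  det : (Fin 3 → A) → (Fin 3 → A) → (Fin 3 → A) → A
  det u w y = u · (w ⨯ y)

  δ : Fin 3 → Fin 3 → A
  δ 0F 0F = one
  δ 1F 1F = one
  δ 2F 2F = one
  δ _ _ = zero

module LinearAlgebra (F : FiniteField) where
  open FiniteField F using (Carrier; _≟_; inverse; 0≢1; isCommutativeRing)
  open Geometry F
  open CommutativeRingSolver isCommutativeRing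
  open CommutativeRing commutativeRing
    using (_+_; _*_; -_; _-_; 0#; 1#; semiring; zeroˡ; zeroʳ; *-identityˡ; +-identityˡ; +-identityʳ; +-comm; *-assoc)
  open Vector₃ _+_ _*_ -_ 0# 1# using (_·_; _⨯_; det; δ)
  private module Poly {n} = Vector₃ (_:+_ {n}) _:*_ :-_ (con (0 , 0)) (con (1 , 0))
  open import Algebra.Properties.Semiring.Sum semiring using (sum; sum-cong-≗; ∑-distrib-+; *-distribˡ-sum)
  open ≡-Reasoning

  1≢0 : 1# ≢ 0#
  1≢0 = 0≢1 ∘ sym

  ∃-inverseˡ : ∀ {x} → x ≢ 0# → Σ Carrier λ x⁻¹ → ∀ y → y ≡ x⁻¹ * (x * y)
  ∃-inverseˡ {x} x≢0 with inverse x x≢0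
  ... | x⁻¹ , xx⁻¹≡1 = x⁻¹ , λ y → begin
    y              ≡⟨ sym (*-identityˡ y) ⟩
    1# * y         ≡⟨ cong (_* y) (sym xx⁻¹≡1) ⟩
    (x * x⁻¹) * y  ≡⟨ solve 3 (λ x x⁻¹ y → (x :* x⁻¹) :* y := x⁻¹ :* (x :* y)) refl x x⁻¹ y ⟩
    x⁻¹ * (x * y)  ∎

  x≢0∧x*y≡0⇒y≡0 : ∀ {x y} → x ≢ 0# → x * y ≡ 0# → y ≡ 0#
  x≢0∧x*y≡0⇒y≡0 {x} {y} x≢0 xy≡0 with ∃-inverseˡ x≢0
  ... | x⁻¹ , y≡x⁻¹xy = trans (y≡x⁻¹xy y) (trans (cong (x⁻¹ *_) xy≡0) (zeroʳ x⁻¹))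

  x-y≡0⇒x≡y : ∀ {x y} → x - y ≡ 0# → x ≡ y
  x-y≡0⇒x≡y {x} {y} x-y≡0 = begin
    x                ≡⟨ solve 2 (λ x y → x := (x :- y) :+ y) refl x y ⟩
    (x - y) + y      ≡⟨ cong (_+ y) x-y≡0 ⟩
    0# + y           ≡⟨ solve 1 (λ y → con (0 , 0) :+ y := y) refl y ⟩
    y                ∎

  ∑≡sum : ∀ {k} (f : Fin k → Carrier) → ∑ f ≡ sum f
  ∑≡sum {zero} f = refl
  ∑≡sum {suc k} f = cong (f zero +_) (∑≡sum (f ∘ suc))

  ∑-cong : ∀ {k} {f g : Fin k → Carrier} → f ≗ g → ∑ f ≡ ∑ g
  ∑-cong {f = f} {g} f≗g = trans (∑≡sum f) (trans (sum-cong-≗ f≗g) (sym (∑≡sum g)))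

  ∑-zero : ∀ {k} {f : Fin k → Carrier} → (∀ i → f i ≡ 0#) → ∑ f ≡ 0#
  ∑-zero {zero} f≡0 = refl
  ∑-zero {suc k} f≡0 = trans (cong₂ _+_ (f≡0 zero) (∑-zero (f≡0 ∘ suc))) (+-identityʳ 0#)

  ∑-linear : ∀ {k} a b (f g : Fin k → Carrier) → a * ∑ f + b * ∑ g ≡ ∑ (λ i → a * f i + b * g i)
  ∑-linear {k} a b f g = begin
    a * ∑ f + b * ∑ g                          ≡⟨ cong₂ (λ s t → a * s + b * t) (∑≡sum f) (∑≡sum g) ⟩
    a * sum f + b * sum g                      ≡⟨ cong₂ _+_ (*-distribˡ-sum a f) (*-distribˡ-sum b g) ⟩
    sum (λ i → a * f i) + sum (λ i → b * g i)  ≡⟨ sym (∑-distrib-+ {k} _ _) ⟩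
    sum (λ i → a * f i + b * g i)              ≡⟨ sym (∑≡sum {k} _) ⟩
    ∑ (λ i → a * f i + b * g i)                ∎

  lincomb : ∀ {k} → (Fin k → Carrier) → (Fin k → V) → V
  lincomb c b j = ∑ (λ i → c i * b i j)

  unit : ∀ {k} → Fin k → Fin k → Carrier
  unit zero zero = 1#
  unit zero (suc _) = 0#
  unit (suc _) zero = 0#
  unit (suc i) (suc i′) = unit i i′

  pair : Carrier → Carrier → Fin 2 → Carrier
  pair a b 0F = a
  pair a b 1F = b

  unit-diagonal : ∀ {k} (i : Fin k) → unit i i ≡ 1#
  unit-diagonal zero = refl
  unit-diagonal (suc i) = unit-diagonal i

  lincomb-zero : ∀ {k} (b : Fin k → V) j → lincomb (λ _ → 0#) b j ≡ 0#
  lincomb-zero {k} b j = ∑-zero {k} (λ i → zeroˡ (b i j))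

  lincomb-unit : ∀ {k} (b : Fin k → V) i j → lincomb (unit i) b j ≡ b i j
  lincomb-unit {suc k} b zero j = begin
    1# * b zero j + lincomb (λ _ → 0#) (b ∘ suc) j  ≡⟨ cong (1# * b zero j +_) (lincomb-zero (b ∘ suc) j) ⟩
    1# * b zero j + 0#                             ≡⟨ solve 1 (λ x → con (1 , 0) :* x :+ con (0 , 0) := x) refl (b zero j) ⟩
    b zero j                                       ∎
  lincomb-unit b (suc i) j = trans (cong₂ _+_ (zeroˡ _) (lincomb-unit (b ∘ suc) i j)) (+-identityˡ _)

  lincomb-linear : ∀ {k} (b : Fin k → V) a c d e j →
                   a * lincomb c b j + d * lincomb e b j ≡ lincomb (λ i → a * c i + d * e i) b j
  lincomb-linear b a c d e j = trans (∑-linear a d (λ i → c i * b i j) (λ i → e i * b i j)) (∑-cong λ i →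
    solve 5 (λ a c d e x → a :* (c :* x) :+ d :* (e :* x) := (a :* c :+ d :* e) :* x) refl a (c i) d (e i) (b i j))

  lincomb-cong : ∀ {k} (b : Fin k → V) {c c′} → (∀ i → c i ≡ c′ i) → ∀ j → lincomb c b j ≡ lincomb c′ b j
  lincomb-cong b c≡c′ j = ∑-cong λ i → cong (_* b i j) (c≡c′ i)

  lincomb-injective : ∀ {k} {b : Fin k → V} → LinIndep b →
                      ∀ {c c′} → (∀ j → lincomb c b j ≡ lincomb c′ b j) → ∀ i → c i ≡ c′ i
  lincomb-injective {b = b} independent {c} {c′} same i = x-y≡0⇒x≡y (trans
    (solve 2 (λ x y → x :- y := con (1 , 0) :* x :+ :- con (1 , 0) :* y) refl (c i) (c′ i))
    (independent (λ i → 1# * c i + - 1# * c′ i) (λ j → begin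
      lincomb (λ i → 1# * c i + - 1# * c′ i) b j        ≡⟨ sym (lincomb-linear b 1# c (- 1#) c′ j) ⟩
      1# * lincomb c b j + - 1# * lincomb c′ b j        ≡⟨ cong (λ x → 1# * x + - 1# * lincomb c′ b j) (same j) ⟩
      1# * lincomb c′ b j + - 1# * lincomb c′ b j       ≡⟨ solve 1 (λ x → con (1 , 0) :* x :+ :- con (1 , 0) :* x
                                                                        := con (0 , 0)) refl _ ⟩
      0#                                                ∎) i))

  basis-∈ : ∀ {k} (b : Fin k → V) i → b i ∈⟨ b ⟩
  basis-∈ b i = unit i , λ j → sym (lincomb-unit b i j)

  ∈-resp-≗ : ∀ {k} {b : Fin k → V} {v w} → v ≗ w → v ∈⟨ b ⟩ → w ∈⟨ b ⟩
  ∈-resp-≗ v≗w (c , v≡) = c , λ j → trans (sym (v≗w j)) (v≡ j)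

  zero-∈ : ∀ {k} {b : Fin k → V} {v} → IsZero v → v ∈⟨ b ⟩
  zero-∈ {b = b} v≡0 = (λ _ → 0#) , λ j → trans (v≡0 j) (sym (lincomb-zero b j))

  ∈-combine : ∀ {k} {b : Fin k → V} {v w} → v ∈⟨ b ⟩ → w ∈⟨ b ⟩ →
              ∀ a d → (λ j → a * v j + d * w j) ∈⟨ b ⟩
  ∈-combine {b = b} (c , v≡) (e , w≡) a d = (λ i → a * c i + d * e i) , λ j →
    trans (cong₂ (λ x y → a * x + d * y) (v≡ j) (w≡ j)) (lincomb-linear b a c d e j)

  ∈-scale : ∀ {k} {b : Fin k → V} {v} → v ∈⟨ b ⟩ → ∀ a → (λ j → a * v j) ∈⟨ b ⟩
  ∈-scale v∈ a = ∈-resp-≗ (λ j → solve 2 (λ a x → a :* x :+ con (0 , 0) :* x := a :* x) refl a _) (∈-combine v∈ v∈ a 0#)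

  ∈-sub : ∀ {k} {b : Fin k → V} {v w} → v ∈⟨ b ⟩ → w ∈⟨ b ⟩ → (λ j → v j - w j) ∈⟨ b ⟩
  ∈-sub v∈ w∈ = ∈-resp-≗ (λ j → solve 2 (λ x y → con (1 , 0) :* x :+ :- con (1 , 0) :* y := x :- y) refl _ _)
                          (∈-combine v∈ w∈ 1# (- 1#))

  span-⊆ : ∀ {k k′} {b : Fin k → V} {b′ : Fin k′ → V} →
           (∀ i → b′ i ∈⟨ b ⟩) → ∀ {v} → v ∈⟨ b′ ⟩ → v ∈⟨ b ⟩
  span-⊆ {k′ = zero} b′⊆b (c , v≡) = zero-∈ v≡
  span-⊆ {k′ = suc k′} b′⊆b (c , v≡) = ∈-resp-≗
    (λ j → trans (solve 2 (λ x y → x :+ con (1 , 0) :* y := x :+ y) refl _ _) (sym (v≡ j)))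
    (∈-combine (b′⊆b zero) (span-⊆ (b′⊆b ∘ suc) (c ∘ suc , λ j → refl)) (c zero) 1#)

  independent⇒nonzero : ∀ {k} {b : Fin k → V} → LinIndep b → ∀ i → NonZero (b i)
  independent⇒nonzero {b = b} independent i bi≡0 =
    1≢0 (trans (sym (unit-diagonal i)) (independent (unit i) (λ j → trans (lincomb-unit b i j) (bi≡0 j)) i))

  multiples-proportional : ∀ {x v w : V} {a b} → (∀ j → v j ≡ a * x j) → (∀ j → w j ≡ b * x j) →
                           NonZero w → ∃[ c ] (∀ j → v j ≡ c * w j)
  multiples-proportional {x} {v} {w} {a} {b} v≡ w≡ w≢0 with b ≟ 0#
  ... | yes b≡0 = ⊥-elim (w≢0 λ j → trans (w≡ j) (trans (cong (_* x j) b≡0) (zeroˡ _)))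
  ... | no b≢0 with ∃-inverseˡ b≢0
  ... | b⁻¹ , y≡b⁻¹by = a * b⁻¹ , λ j → begin
    v j                    ≡⟨ v≡ j ⟩
    a * x j                ≡⟨ cong (a *_) (y≡b⁻¹by (x j)) ⟩
    a * (b⁻¹ * (b * x j))  ≡⟨ sym (*-assoc a b⁻¹ (b * x j)) ⟩
    (a * b⁻¹) * (b * x j)  ≡⟨ cong ((a * b⁻¹) *_) (sym (w≡ j)) ⟩
    (a * b⁻¹) * w j        ∎

  dependent⇒proportional : ∀ {v w : V} {a b} → (a ≢ 0# ⊎ b ≢ 0#) → (∀ j → a * v j + b * w j ≡ 0#) →
                           NonZero w → ∃[ c ] (∀ j → v j ≡ c * w j)
  dependent⇒proportional {v} {w} {a} {b} nontrivial rel w≢0 with a ≟ 0# | nontrivial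
  ... | yes a≡0 | inj₁ a≢0 = ⊥-elim (a≢0 a≡0)
  ... | yes a≡0 | inj₂ b≢0 = ⊥-elim (w≢0 λ j → x≢0∧x*y≡0⇒y≡0 b≢0 (begin
    b * w j              ≡⟨ solve 3 (λ b x y → b :* y := con (0 , 0) :* x :+ b :* y) refl b (v j) (w j) ⟩
    0# * v j + b * w j   ≡⟨ cong (λ α → α * v j + b * w j) (sym a≡0) ⟩
    a * v j + b * w j    ≡⟨ rel j ⟩
    0#                   ∎))
  ... | no a≢0 | _ with ∃-inverseˡ a≢0
  ... | a⁻¹ , y≡a⁻¹ay = - (a⁻¹ * b) , λ j → begin
    v j                                            ≡⟨ y≡a⁻¹ay (v j) ⟩
    a⁻¹ * (a * v j)                                ≡⟨ solve 5 (λ a a⁻¹ b x y → a⁻¹ :* (a :* x)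
                                                        := a⁻¹ :* (a :* x :+ b :* y) :+ (:- (a⁻¹ :* b)) :* y)
                                                        refl a a⁻¹ b (v j) (w j) ⟩
    a⁻¹ * (a * v j + b * w j) + - (a⁻¹ * b) * w j  ≡⟨ cong (λ z → a⁻¹ * z + - (a⁻¹ * b) * w j) (rel j) ⟩
    a⁻¹ * 0# + - (a⁻¹ * b) * w j                   ≡⟨ solve 2 (λ μ y → μ :* con (0 , 0) :+ y := y) refl a⁻¹ _ ⟩
    - (a⁻¹ * b) * w j                              ∎

  SameSpan-refl : ∀ {k} (b : Fin k → V) → SameSpan b b
  SameSpan-refl b v = (λ v∈ → v∈) , (λ v∈ → v∈)

  SameSpan-sym : ∀ {k l} {b : Fin k → V} {b′ : Fin l → V} → SameSpan b b′ → SameSpan b′ b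
  SameSpan-sym same v = proj₂ (same v) , proj₁ (same v)

  Bf-term : V → V → Fin 3 → Carrier
  Bf-term x y i = x (i ↑ˡ 3) * y (3 ↑ʳ i) - x (3 ↑ʳ i) * y (i ↑ˡ 3)

  Bf-congʳ : ∀ x {v w} → v ≗ w → Bf x v ≡ Bf x w
  Bf-congʳ x v≗w = ∑-cong λ i → cong₂ (λ a b → x (i ↑ˡ 3) * a - x (3 ↑ʳ i) * b) (v≗w (3 ↑ʳ i)) (v≗w (i ↑ˡ 3))

  Bf-zeroʳ : ∀ x {v} → IsZero v → Bf x v ≡ 0#
  Bf-zeroʳ x v≡0 = trans (Bf-congʳ x v≡0) (∑-zero {3} λ i →
    solve 2 (λ a b → a :* con (0 , 0) :- b :* con (0 , 0) := con (0 , 0)) refl (x (i ↑ˡ 3)) (x (3 ↑ʳ i)))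

  Bf-linearʳ : ∀ x a y z → Bf x (λ j → a * y j + z j) ≡ a * Bf x y + Bf x z
  Bf-linearʳ x a y z = begin
    Bf x (λ j → a * y j + z j)                        ≡⟨ ∑-cong (λ i → term (x (i ↑ˡ 3)) (x (3 ↑ʳ i))
                                                                          (y (i ↑ˡ 3)) (y (3 ↑ʳ i)) (z (i ↑ˡ 3)) (z (3 ↑ʳ i))) ⟩
    ∑ (λ i → a * Bf-term x y i + 1# * Bf-term x z i)  ≡⟨ sym (∑-linear a 1# (Bf-term x y) (Bf-term x z)) ⟩
    a * Bf x y + 1# * Bf x z                          ≡⟨ cong (a * Bf x y +_) (*-identityˡ _) ⟩
    a * Bf x y + Bf x z                               ∎
    where
    term : ∀ x₁ x₂ y₁ y₂ z₁ z₂ →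
           x₁ * (a * y₂ + z₂) - x₂ * (a * y₁ + z₁) ≡ a * (x₁ * y₂ - x₂ * y₁) + 1# * (x₁ * z₂ - x₂ * z₁)
    term = solve 7 (λ a x₁ x₂ y₁ y₂ z₁ z₂ → x₁ :* (a :* y₂ :+ z₂) :- x₂ :* (a :* y₁ :+ z₁)
                   := a :* (x₁ :* y₂ :- x₂ :* y₁) :+ con (1 , 0) :* (x₁ :* z₂ :- x₂ :* z₁)) refl a

  Bf-alternating : ∀ x → Bf x x ≡ 0#
  Bf-alternating x = ∑-zero {3} λ i → solve 2 (λ a b → a :* b :- b :* a := con (0 , 0)) refl (x (i ↑ˡ 3)) (x (3 ↑ʳ i))

  Bf-sym-zero : ∀ x y → Bf x y ≡ 0# → Bf y x ≡ 0#
  Bf-sym-zero x y Bxy≡0 = begin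
    Bf y x                                                ≡⟨ ∑-cong (λ i → swap (x (i ↑ˡ 3)) (x (3 ↑ʳ i))
                                                                              (y (i ↑ˡ 3)) (y (3 ↑ʳ i))) ⟩
    ∑ (λ i → - 1# * Bf-term x y i + 0# * Bf-term x y i)  ≡⟨ sym (∑-linear (- 1#) 0# (Bf-term x y) (Bf-term x y)) ⟩
    - 1# * Bf x y + 0# * Bf x y                          ≡⟨ cong (λ β → - 1# * β + 0# * β) Bxy≡0 ⟩
    - 1# * 0# + 0# * 0#                                  ≡⟨ solve 0 (:- con (1 , 0) :* con (0 , 0) :+ con (0 , 0) :* con (0 , 0)
                                                                     := con (0 , 0)) refl ⟩
    0#                                                   ∎
    where
    swap : ∀ x₁ x₂ y₁ y₂ → y₁ * x₂ - y₂ * x₁ ≡ - 1# * (x₁ * y₂ - x₂ * y₁) + 0# * (x₁ * y₂ - x₂ * y₁)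
    swap = solve 4 (λ x₁ x₂ y₁ y₂ → y₁ :* x₂ :- y₂ :* x₁
                   := :- con (1 , 0) :* (x₁ :* y₂ :- x₂ :* y₁) :+ con (0 , 0) :* (x₁ :* y₂ :- x₂ :* y₁)) refl

  Bf-∈ : ∀ {k} {b : Fin k → V} x → (∀ i → Bf x (b i) ≡ 0#) → ∀ {v} → v ∈⟨ b ⟩ → Bf x v ≡ 0#
  Bf-∈ {zero} x _ (c , v≡) = Bf-zeroʳ x v≡
  Bf-∈ {suc k} {b} x x⊥b {v} (c , v≡) = begin
    Bf x v
      ≡⟨ Bf-congʳ x v≡ ⟩
    Bf x (λ j → c zero * b zero j + lincomb (c ∘ suc) (b ∘ suc) j)
      ≡⟨ Bf-linearʳ x (c zero) (b zero) (lincomb (c ∘ suc) (b ∘ suc)) ⟩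
    c zero * Bf x (b zero) + Bf x (lincomb (c ∘ suc) (b ∘ suc))
      ≡⟨ cong₂ (λ s t → c zero * s + t) (x⊥b zero) (Bf-∈ {b = b ∘ suc} x (x⊥b ∘ suc) (c ∘ suc , λ j → refl)) ⟩
    c zero * 0# + 0#
      ≡⟨ solve 1 (λ a → a :* con (0 , 0) :+ con (0 , 0) := con (0 , 0)) refl (c zero) ⟩
    0#
      ∎

  -- Linear algebra in GF(q)³

  V₃ : Set
  V₃ = Fin 3 → Carrier

  ⨯-⨯ : ∀ y a b t → (y ⨯ (a ⨯ b)) t ≡ (b · y) * a t - (a · y) * b t
  ⨯-⨯ y a b = λ where
      0F → solve 9 (identity 0F) refl (y 0F) (y 1F) (y 2F) (a 0F) (a 1F) (a 2F) (b 0F) (b 1F) (b 2F)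
      1F → solve 9 (identity 1F) refl (y 0F) (y 1F) (y 2F) (a 0F) (a 1F) (a 2F) (b 0F) (b 1F) (b 2F)
      2F → solve 9 (identity 2F) refl (y 0F) (y 1F) (y 2F) (a 0F) (a 1F) (a 2F) (b 0F) (b 1F) (b 2F)
    where
    identity : Fin 3 → N-ary 9 (Polynomial 9) (Polynomial 9 × Polynomial 9)
    identity t y₀ y₁ y₂ a₀ a₁ a₂ b₀ b₁ b₂ =
      (y′ Poly.⨯ (a′ Poly.⨯ b′)) t := (b′ Poly.· y′) :* a′ t :- (a′ Poly.· y′) :* b′ t
      where y′ = Poly.vec y₀ y₁ y₂ ; a′ = Poly.vec a₀ a₁ a₂ ; b′ = Poly.vec b₀ b₁ b₂

  det-expansion : ∀ p u w y t → p t * det u w y ≡ (p · u) * (w ⨯ y) t + ((p · w) * (y ⨯ u) t + (p · y) * (u ⨯ w) t)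
  det-expansion p u w y = λ where
      0F → solve 12 (identity 0F) refl (p 0F) (p 1F) (p 2F) (u 0F) (u 1F) (u 2F) (w 0F) (w 1F) (w 2F) (y 0F) (y 1F) (y 2F)
      1F → solve 12 (identity 1F) refl (p 0F) (p 1F) (p 2F) (u 0F) (u 1F) (u 2F) (w 0F) (w 1F) (w 2F) (y 0F) (y 1F) (y 2F)
      2F → solve 12 (identity 2F) refl (p 0F) (p 1F) (p 2F) (u 0F) (u 1F) (u 2F) (w 0F) (w 1F) (w 2F) (y 0F) (y 1F) (y 2F)
    where
    identity : Fin 3 → N-ary 12 (Polynomial 12) (Polynomial 12 × Polynomial 12)
    identity t p₀ p₁ p₂ u₀ u₁ u₂ w₀ w₁ w₂ y₀ y₁ y₂ =
      p′ t :* Poly.det u′ w′ y′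
        := (p′ Poly.· u′) :* (w′ Poly.⨯ y′) t :+ ((p′ Poly.· w′) :* (y′ Poly.⨯ u′) t :+ (p′ Poly.· y′) :* (u′ Poly.⨯ w′) t)
      where
      p′ = Poly.vec p₀ p₁ p₂ ; u′ = Poly.vec u₀ u₁ u₂ ; w′ = Poly.vec w₀ w₁ w₂ ; y′ = Poly.vec y₀ y₁ y₂

  cramer-identity : ∀ u w y t j → (u ⨯ w) t * y j ≡ ((y ⨯ w) t * u j + (u ⨯ y) t * w j) + δ t j * det u w y
  cramer-identity u w y t j = at t j
    where
    identity : Fin 3 → Fin 3 → N-ary 9 (Polynomial 9) (Polynomial 9 × Polynomial 9)
    identity t j u₀ u₁ u₂ w₀ w₁ w₂ y₀ y₁ y₂ =
      (u′ Poly.⨯ w′) t :* y′ j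
        := ((y′ Poly.⨯ w′) t :* u′ j :+ (u′ Poly.⨯ y′) t :* w′ j) :+ Poly.δ t j :* Poly.det u′ w′ y′
      where u′ = Poly.vec u₀ u₁ u₂ ; w′ = Poly.vec w₀ w₁ w₂ ; y′ = Poly.vec y₀ y₁ y₂
    at : ∀ t j → (u ⨯ w) t * y j ≡ ((y ⨯ w) t * u j + (u ⨯ y) t * w j) + δ t j * det u w y
    at 0F 0F = solve 9 (identity 0F 0F) refl (u 0F) (u 1F) (u 2F) (w 0F) (w 1F) (w 2F) (y 0F) (y 1F) (y 2F)
    at 0F 1F = solve 9 (identity 0F 1F) refl (u 0F) (u 1F) (u 2F) (w 0F) (w 1F) (w 2F) (y 0F) (y 1F) (y 2F)
    at 0F 2F = solve 9 (identity 0F 2F) refl (u 0F) (u 1F) (u 2F) (w 0F) (w 1F) (w 2F) (y 0F) (y 1F) (y 2F)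
    at 1F 0F = solve 9 (identity 1F 0F) refl (u 0F) (u 1F) (u 2F) (w 0F) (w 1F) (w 2F) (y 0F) (y 1F) (y 2F)
    at 1F 1F = solve 9 (identity 1F 1F) refl (u 0F) (u 1F) (u 2F) (w 0F) (w 1F) (w 2F) (y 0F) (y 1F) (y 2F)
    at 1F 2F = solve 9 (identity 1F 2F) refl (u 0F) (u 1F) (u 2F) (w 0F) (w 1F) (w 2F) (y 0F) (y 1F) (y 2F)
    at 2F 0F = solve 9 (identity 2F 0F) refl (u 0F) (u 1F) (u 2F) (w 0F) (w 1F) (w 2F) (y 0F) (y 1F) (y 2F)
    at 2F 1F = solve 9 (identity 2F 1F) refl (u 0F) (u 1F) (u 2F) (w 0F) (w 1F) (w 2F) (y 0F) (y 1F) (y 2F)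
    at 2F 2F = solve 9 (identity 2F 2F) refl (u 0F) (u 1F) (u 2F) (w 0F) (w 1F) (w 2F) (y 0F) (y 1F) (y 2F)

  Dependent : V₃ → V₃ → Set
  Dependent y z = Σ Carrier λ a → Σ Carrier λ b → (a ≢ 0# ⊎ b ≢ 0#) × (∀ j → a * y j + b * z j ≡ 0#)

  nonzero-coordinate : ∀ {v : V₃} → ¬ (∀ j → v j ≡ 0#) → ∃[ t ] v t ≢ 0#
  nonzero-coordinate {v} = ¬∀⟶∃¬ 3 (λ j → v j ≡ 0#) (λ j → v j ≟ 0#)

  ⨯-zeroʳ : ∀ y {w} → (∀ j → w j ≡ 0#) → ∀ t → (y ⨯ w) t ≡ 0#
  ⨯-zeroʳ y {w} w≡0 = λ where
      0F → trans (cong₂ (λ a b → y 1F * a - y 2F * b) (w≡0 2F) (w≡0 1F)) (*0-*0 (y 1F) (y 2F))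
      1F → trans (cong₂ (λ a b → y 2F * a - y 0F * b) (w≡0 0F) (w≡0 2F)) (*0-*0 (y 2F) (y 0F))
      2F → trans (cong₂ (λ a b → y 0F * a - y 1F * b) (w≡0 1F) (w≡0 0F)) (*0-*0 (y 0F) (y 1F))
    where
    *0-*0 : ∀ a b → a * 0# - b * 0# ≡ 0#
    *0-*0 = solve 2 (λ a b → a :* con (0 , 0) :- b :* con (0 , 0) := con (0 , 0)) refl

  ·-unit : ∀ (v : V₃) t → v · unit t ≡ v t
  ·-unit v = λ where
      0F → solve 3 (λ a b c → a :* 𝟙 :+ (b :* 𝟘 :+ (c :* 𝟘 :+ 𝟘)) := a) refl (v 0F) (v 1F) (v 2F)
      1F → solve 3 (λ a b c → a :* 𝟘 :+ (b :* 𝟙 :+ (c :* 𝟘 :+ 𝟘)) := b) refl (v 0F) (v 1F) (v 2F)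
      2F → solve 3 (λ a b c → a :* 𝟘 :+ (b :* 𝟘 :+ (c :* 𝟙 :+ 𝟘)) := c) refl (v 0F) (v 1F) (v 2F)
    where
    𝟘 𝟙 : Polynomial 3
    𝟘 = con (0 , 0)
    𝟙 = con (1 , 0)

  ⨯≗0⇒minors-vanish : ∀ {u n : V₃} → (∀ j → (u ⨯ n) j ≡ 0#) → ∀ t j → n t * u j ≡ u t * n j
  ⨯≗0⇒minors-vanish {u} {n} u⨯n≡0 t j = x-y≡0⇒x≡y (begin
    n t * u j - u t * n j                      ≡⟨ cong₂ (λ a b → a * u j - b * n j) (sym (·-unit n t)) (sym (·-unit u t)) ⟩
    (n · unit t) * u j - (u · unit t) * n j    ≡⟨ sym (⨯-⨯ (unit t) u n j) ⟩
    (unit t ⨯ (u ⨯ n)) j                       ≡⟨ ⨯-zeroʳ (unit t) u⨯n≡0 j ⟩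
    0#                                         ∎)

  ⨯≗0⇒dependent : ∀ {u w : V₃} → (∀ j → (u ⨯ w) j ≡ 0#) → Dependent u w
  ⨯≗0⇒dependent {u} {w} u⨯w≡0 with all? (λ j → w j ≟ 0#)
  ... | yes w≡0 = 0# , 1# , inj₂ 1≢0 , λ j → trans (cong (λ b → 0# * u j + 1# * b) (w≡0 j))
                    (solve 1 (λ a → con (0 , 0) :* a :+ con (1 , 0) :* con (0 , 0) := con (0 , 0)) refl (u j))
  ... | no w≢0 with nonzero-coordinate w≢0
  ...   | t , wt≢0 = w t , - u t , inj₁ wt≢0 , λ j → trans (cong (_+ - u t * w j) (⨯≗0⇒minors-vanish u⨯w≡0 t j))
                       (solve 2 (λ a b → a :* b :+ :- a :* b := con (0 , 0)) refl (u t) (w j))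

  common-multiple⇒dependent : ∀ {n y z : V₃} t → n t ≢ 0# →
                              (∀ j → n t * y j ≡ y t * n j) → (∀ j → n t * z j ≡ z t * n j) → Dependent y z
  common-multiple⇒dependent {n} {y} {z} t nt≢0 y∥n z∥n with y t ≟ 0#
  ... | yes yt≡0 = 1# , 0# , inj₁ 1≢0 , λ j → begin
    1# * y j + 0# * z j  ≡⟨ cong (λ c → 1# * c + 0# * z j)
                              (x≢0∧x*y≡0⇒y≡0 nt≢0 (trans (y∥n j) (trans (cong (_* n j) yt≡0) (zeroˡ _)))) ⟩
    1# * 0# + 0# * z j   ≡⟨ solve 1 (λ c → con (1 , 0) :* con (0 , 0) :+ con (0 , 0) :* c := con (0 , 0)) refl (z j) ⟩
    0#                   ∎
  ... | no yt≢0 = - z t , y t , inj₂ yt≢0 , λ j → x≢0∧x*y≡0⇒y≡0 nt≢0 (begin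
    n t * (- z t * y j + y t * z j)          ≡⟨ solve 5 (λ ν η ζ a b → ν :* (:- ζ :* a :+ η :* b)
                                                          := :- ζ :* (ν :* a) :+ η :* (ν :* b)) refl (n t) (y t) (z t) (y j) (z j) ⟩
    - z t * (n t * y j) + y t * (n t * z j)  ≡⟨ cong₂ (λ a b → - z t * a + y t * b) (y∥n j) (z∥n j) ⟩
    - z t * (y t * n j) + y t * (z t * n j)  ≡⟨ solve 3 (λ η ζ ν → :- ζ :* (η :* ν) :+ η :* (ζ :* ν) := con (0 , 0))
                                                          refl (y t) (z t) (n j) ⟩
    0#                                       ∎)

  ⊥-independent-pair⇒dependent : ∀ {a b y z : V₃} → ¬ Dependent a b →
                                 a · y ≡ 0# → b · y ≡ 0# → a · z ≡ 0# → b · z ≡ 0# → Dependent y z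
  ⊥-independent-pair⇒dependent {a} {b} independent a⊥y b⊥y a⊥z b⊥z
    with nonzero-coordinate (independent ∘ ⨯≗0⇒dependent {a} {b})
  ... | t , nt≢0 = common-multiple⇒dependent t nt≢0
    (⨯≗0⇒minors-vanish (⊥-both⇒⨯≡0 a⊥y b⊥y) t) (⨯≗0⇒minors-vanish (⊥-both⇒⨯≡0 a⊥z b⊥z) t)
    where
    ⊥-both⇒⨯≡0 : ∀ {v} → a · v ≡ 0# → b · v ≡ 0# → ∀ j → (v ⨯ (a ⨯ b)) j ≡ 0#
    ⊥-both⇒⨯≡0 {v} a⊥v b⊥v j = trans (⨯-⨯ v a b j) (trans (cong₂ (λ r s → r * a j - s * b j) b⊥v a⊥v)
      (solve 2 (λ x y → con (0 , 0) :* x :- con (0 , 0) :* y := con (0 , 0)) refl (a j) (b j)))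

  ⊥-nonzero⇒∈span : ∀ {p u w y : V₃} s → p s ≢ 0# → ¬ Dependent u w →
                    p · u ≡ 0# → p · w ≡ 0# → p · y ≡ 0# →
                    Σ Carrier λ α → Σ Carrier λ β → ∀ j → y j ≡ α * u j + β * w j
  ⊥-nonzero⇒∈span {p} {u} {w} {y} s ps≢0 independent p⊥u p⊥w p⊥y
    with nonzero-coordinate (independent ∘ ⨯≗0⇒dependent {u} {w})
  ... | t , nt≢0 with ∃-inverseˡ nt≢0
  ... | n⁻¹ , y≡n⁻¹ny = n⁻¹ * (y ⨯ w) t , n⁻¹ * (u ⨯ y) t , λ j → begin
    y j
      ≡⟨ y≡n⁻¹ny (y j) ⟩
    n⁻¹ * ((u ⨯ w) t * y j)
      ≡⟨ cong (n⁻¹ *_) (cramer-identity u w y t j) ⟩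
    n⁻¹ * (((y ⨯ w) t * u j + (u ⨯ y) t * w j) + δ t j * det u w y)
      ≡⟨ cong (λ d → n⁻¹ * (((y ⨯ w) t * u j + (u ⨯ y) t * w j) + δ t j * d)) det≡0 ⟩
    n⁻¹ * (((y ⨯ w) t * u j + (u ⨯ y) t * w j) + δ t j * 0#)
      ≡⟨ solve 6 (λ μ α β a b d → μ :* ((α :* a :+ β :* b) :+ d :* con (0 , 0)) := (μ :* α) :* a :+ (μ :* β) :* b)
                 refl n⁻¹ _ _ (u j) (w j) (δ t j) ⟩
    (n⁻¹ * (y ⨯ w) t) * u j + (n⁻¹ * (u ⨯ y) t) * w j
      ∎
    where
    det≡0 : det u w y ≡ 0#
    det≡0 = x≢0∧x*y≡0⇒y≡0 ps≢0 (begin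
      p s * det u w y
        ≡⟨ det-expansion p u w y s ⟩
      (p · u) * (w ⨯ y) s + ((p · w) * (y ⨯ u) s + (p · y) * (u ⨯ w) s)
        ≡⟨ cong₂ (λ a b → a * (w ⨯ y) s + b) p⊥u (cong₂ (λ c d → c * (y ⨯ u) s + d * (u ⨯ w) s) p⊥w p⊥y) ⟩
      0# * (w ⨯ y) s + (0# * (y ⨯ u) s + 0# * (u ⨯ w) s)
        ≡⟨ solve 3 (λ a b c → con (0 , 0) :* a :+ (con (0 , 0) :* b :+ con (0 , 0) :* c) := con (0 , 0)) refl _ _ _ ⟩
      0#
        ∎)

  coordinate-split : ∀ (Q : Fin 6 → Set) → (∀ (i : Fin 3) → Q (i ↑ˡ 3)) → (∀ i → Q (3 ↑ʳ i)) → ∀ j → Q j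
  coordinate-split Q q₁ q₂ 0F = q₁ 0F
  coordinate-split Q q₁ q₂ 1F = q₁ 1F
  coordinate-split Q q₁ q₂ 2F = q₁ 2F
  coordinate-split Q q₁ q₂ 3F = q₂ 0F
  coordinate-split Q q₁ q₂ 4F = q₂ 1F
  coordinate-split Q q₁ q₂ 5F = q₂ 2F

  front back : V → V₃
  front v i = v (i ↑ˡ 3)
  back v i = v (3 ↑ʳ i)

  Π₁∩Π₂≡0 : ∀ {v} → InΠ₁ v → InΠ₂ v → IsZero v
  Π₁∩Π₂≡0 {v} = coordinate-split (λ j → v j ≡ 0#)

  Π₁-line-combination : ∀ {v} {ℓ : Fin 2 → V} α β → InΠ₁ v → (∀ i → InΠ₁ (ℓ i)) →
                        (∀ i → back v i ≡ α * back (ℓ 0F) i + β * back (ℓ 1F) i) → ∀ j → v j ≡ lincomb (pair α β) ℓ j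
  Π₁-line-combination {v} {ℓ} α β v∈Π₁ ℓ∈Π₁ back≡ = coordinate-split (λ j → v j ≡ α * ℓ 0F j + (β * ℓ 1F j + 0#))
    (λ i → trans (v∈Π₁ i) (sym (trans (cong₂ (λ x y → α * x + (β * y + 0#)) (ℓ∈Π₁ 0F i) (ℓ∈Π₁ 1F i))
             (solve 2 (λ α β → α :* con (0 , 0) :+ (β :* con (0 , 0) :+ con (0 , 0)) := con (0 , 0)) refl α β))))
    (λ i → trans (back≡ i) (solve 2 (λ x y → x :+ y := x :+ (y :+ con (0 , 0))) refl _ _))

  Bf-Π₂ : ∀ x y → InΠ₂ x → Bf x y ≡ front x · back y
  Bf-Π₂ x y x∈Π₂ = ∑-cong λ i → trans (cong (λ c → x (i ↑ˡ 3) * y (3 ↑ʳ i) - c * y (i ↑ˡ 3)) (x∈Π₂ i))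
    (solve 3 (λ a b c → a :* b :- con (0 , 0) :* c := a :* b) refl _ _ _)

  Π₂-isotropic : ∀ {x y} → InΠ₂ x → InΠ₂ y → Bf x y ≡ 0#
  Π₂-isotropic {x} {y} x∈Π₂ y∈Π₂ = trans (Bf-Π₂ x y x∈Π₂) (∑-zero {3} λ i → trans (cong (front x i *_) (y∈Π₂ i)) (zeroʳ _))

  Π₂basis∈Π₂ : ∀ i → InΠ₂ (Π₂basis i)
  Π₂basis∈Π₂ 0F _ = refl
  Π₂basis∈Π₂ 1F _ = refl
  Π₂basis∈Π₂ 2F _ = refl

  -- Π₂basis i′ (i ↑ˡ 3) computes to unit i i′, so the left-hand side is c · unit i.
  Π₂basis-front : ∀ c i → lincomb c Π₂basis (i ↑ˡ 3) ≡ c i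
  Π₂basis-front c 0F = ·-unit c 0F
  Π₂basis-front c 1F = ·-unit c 1F
  Π₂basis-front c 2F = ·-unit c 2F

  Π₂basis-back : ∀ c i → lincomb c Π₂basis (3 ↑ʳ i) ≡ 0#
  Π₂basis-back c i = ∑-zero {3} λ i′ → trans (cong (c i′ *_) (Π₂basis∈Π₂ i′ i)) (zeroʳ _)

  ∈Π₂basis⇒InΠ₂ : ∀ {v} → v ∈⟨ Π₂basis ⟩ → InΠ₂ v
  ∈Π₂basis⇒InΠ₂ (c , v≡) i = trans (v≡ (3 ↑ʳ i)) (Π₂basis-back c i)

  InΠ₂⇒∈Π₂basis : ∀ {v} → InΠ₂ v → v ∈⟨ Π₂basis ⟩
  InΠ₂⇒∈Π₂basis {v} v∈Π₂ = front v , coordinate-split (λ j → v j ≡ lincomb (front v) Π₂basis j)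
    (λ i → sym (Π₂basis-front (front v) i)) (λ i → trans (v∈Π₂ i) (sym (Π₂basis-back (front v) i)))

  Π₂-generator : IsGenerator Π₂basis
  Π₂-generator = (λ c c≡0 i → trans (sym (Π₂basis-front c i)) (c≡0 (i ↑ˡ 3)))
               , (λ i j → Π₂-isotropic {Π₂basis i} {Π₂basis j} (Π₂basis∈Π₂ i) (Π₂basis∈Π₂ j))

  Π₂-disjoint-Π₁ : DisjointFromΠ₁ Π₂basis
  Π₂-disjoint-Π₁ v v∈Π₂ v∈Π₁ = Π₁∩Π₂≡0 v∈Π₁ (∈Π₂basis⇒InΠ₂ v∈Π₂)

  point : Pt2 → V₃
  point P = front (pvec P)

  pvec∈Π₂ : ∀ P → InΠ₂ (pvec P)
  pvec∈Π₂ (pt-a _ _) i = refl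
  pvec∈Π₂ (pt-b _) i = refl
  pvec∈Π₂ pt-c i = refl

  point-nonzero : ∀ P → ∃[ t ] point P t ≢ 0#
  point-nonzero (pt-a _ _) = 0F , 1≢0
  point-nonzero (pt-b _) = 1F , 1≢0
  point-nonzero pt-c = 2F , 1≢0

  back⊥point : ∀ P v → Bf (pvec P) v ≡ 0# → point P · back v ≡ 0#
  back⊥point P v P⊥v = trans (sym (Bf-Π₂ (pvec P) v (pvec∈Π₂ P))) P⊥v

  _≟ₚ_ : (P P′ : Pt2) → Dec (P ≡ P′)
  pt-a a b ≟ₚ pt-a a′ b′ with a ≟ a′ | b ≟ b′
  ... | yes refl | yes refl = yes refl
  ... | no a≢a′ | _ = no λ { refl → a≢a′ refl }
  ... | yes _ | no b≢b′ = no λ { refl → b≢b′ refl }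
  pt-a _ _ ≟ₚ pt-b _ = no λ ()
  pt-a _ _ ≟ₚ pt-c = no λ ()
  pt-b _ ≟ₚ pt-a _ _ = no λ ()
  pt-b a ≟ₚ pt-b a′ with a ≟ a′
  ... | yes refl = yes refl
  ... | no a≢a′ = no λ { refl → a≢a′ refl }
  pt-b _ ≟ₚ pt-c = no λ ()
  pt-c ≟ₚ pt-a _ _ = no λ ()
  pt-c ≟ₚ pt-b _ = no λ ()
  pt-c ≟ₚ pt-c = yes refl

  other : Pt2 → Pt2
  other (pt-a _ _) = pt-c
  other (pt-b _) = pt-c
  other pt-c = pt-b 0#

  other≢ : ∀ P → other P ≢ P
  other≢ (pt-a _ _) ()
  other≢ (pt-b _) ()
  other≢ pt-c ()

  pvec-nonzero : ∀ P → NonZero (pvec P)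
  pvec-nonzero P P≡0 = proj₂ (point-nonzero P) (P≡0 (proj₁ (point-nonzero P) ↑ˡ 3))

  private
    earlier-leading : ∀ {a b} → a * 1# + b * 0# ≡ 0# → a ≡ 0#
    earlier-leading {a} {b} e = trans (solve 2 (λ a b → a := a :* con (1 , 0) :+ b :* con (0 , 0)) refl a b) e

    later-leading : ∀ {a b c} → a * 0# + b * 1# ≡ 0# → a * 1# + b * c ≡ 0# → a ≡ 0#
    later-leading {a} {b} {c} e₀ e₁ = begin
      a                 ≡⟨ solve 2 (λ a c → a := a :* con (1 , 0) :+ con (0 , 0) :* c) refl a c ⟩
      a * 1# + 0# * c   ≡⟨ cong (λ β → a * 1# + β * c) (sym b≡0) ⟩
      a * 1# + b * c    ≡⟨ e₁ ⟩
      0#                ∎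
      where
      b≡0 : b ≡ 0#
      b≡0 = trans (solve 2 (λ a b → b := a :* con (0 , 0) :+ b :* con (1 , 0)) refl a b) e₀

    same-leading : ∀ {a b c c′} → a * 1# + b * 1# ≡ 0# → a * c + b * c′ ≡ 0# → c ≢ c′ → a ≡ 0#
    same-leading {a} {b} {c} {c′} e₀ e₁ c≢c′ = x≢0∧x*y≡0⇒y≡0 (c≢c′ ∘ x-y≡0⇒x≡y) (begin
      (c - c′) * a                               ≡⟨ solve 4 (λ a b c c′ → (c :- c′) :* a
                                                        := (a :* c :+ b :* c′) :- c′ :* (a :* con (1 , 0) :+ b :* con (1 , 0)))
                                                        refl a b c c′ ⟩
      (a * c + b * c′) - c′ * (a * 1# + b * 1#)  ≡⟨ cong₂ (λ r s → r - c′ * s) e₁ e₀ ⟩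
      0# - c′ * 0#                               ≡⟨ solve 1 (λ c′ → con (0 , 0) :- c′ :* con (0 , 0) := con (0 , 0)) refl c′ ⟩
      0#                                         ∎)

  -- The coefficient of P vanishes at the first coordinate where the normalised points differ.
  coefficient-vanishes : ∀ {P P′ a b} → P ≢ P′ → (∀ j → a * point P j + b * point P′ j ≡ 0#) → a ≡ 0#
  coefficient-vanishes {pt-a x y} {pt-a x′ y′} P≢P′ rel with x ≟ x′ | y ≟ y′
  ... | yes refl | yes refl = ⊥-elim (P≢P′ refl)
  ... | no x≢x′ | _ = same-leading (rel 0F) (rel 1F) x≢x′
  ... | yes refl | no y≢y′ = same-leading (rel 0F) (rel 2F) y≢y′
  coefficient-vanishes {pt-a _ _} {pt-b _} _ rel = earlier-leading (rel 0F)
  coefficient-vanishes {pt-a _ _} {pt-c} _ rel = earlier-leading (rel 0F)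
  coefficient-vanishes {pt-b _} {pt-a _ _} _ rel = later-leading (rel 0F) (rel 1F)
  coefficient-vanishes {pt-b x} {pt-b x′} P≢P′ rel with x ≟ x′
  ... | yes refl = ⊥-elim (P≢P′ refl)
  ... | no x≢x′ = same-leading (rel 1F) (rel 2F) x≢x′
  coefficient-vanishes {pt-b _} {pt-c} _ rel = earlier-leading (rel 1F)
  coefficient-vanishes {pt-c} {pt-a _ _} _ rel = later-leading (rel 0F) (rel 2F)
  coefficient-vanishes {pt-c} {pt-b _} _ rel = later-leading (rel 1F) (rel 2F)
  coefficient-vanishes {pt-c} {pt-c} P≢P′ _ = ⊥-elim (P≢P′ refl)

  distinct-points-independent : ∀ {P P′} → P ≢ P′ → ¬ Dependent (point P) (point P′)
  distinct-points-independent P≢P′ (a , b , nontrivial , rel) with nontrivial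
  ... | inj₁ a≢0 = a≢0 (coefficient-vanishes P≢P′ rel)
  ... | inj₂ b≢0 = b≢0 (coefficient-vanishes (P≢P′ ∘ sym) λ j → trans (+-comm _ _) (rel j))

  multiple-of-two-points⇒zero : ∀ {P P′ w a b} → P ≢ P′ →
                                (∀ j → w j ≡ a * pvec P j) → (∀ j → w j ≡ b * pvec P′ j) → IsZero w
  multiple-of-two-points⇒zero {P} {P′} {w} {a} {b} P≢P′ w≡aP w≡bP′ with a ≟ 0#
  ... | yes a≡0 = λ j → trans (w≡aP j) (trans (cong (_* pvec P j) a≡0) (zeroˡ _))
  ... | no a≢0 = ⊥-elim (distinct-points-independent P≢P′ (a , - b , inj₁ a≢0 , λ i → begin
    a * point P i + - b * point P′ i  ≡⟨ solve 4 (λ a b x y → a :* x :+ :- b :* y := a :* x :- b :* y) refl a b _ _ ⟩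
    a * point P i - b * point P′ i    ≡⟨ cong₂ _-_ (sym (w≡aP (i ↑ˡ 3))) (sym (w≡bP′ (i ↑ˡ 3))) ⟩
    w (i ↑ˡ 3) - w (i ↑ˡ 3)          ≡⟨ solve 1 (λ x → x :- x := con (0 , 0)) refl _ ⟩
    0#                              ∎))

  -- Planes through a point of Π₂

  record PlaneAt (P : Pt2) (π : Fin 3 → V) : Set where
    field
      through    : pvec P ∈⟨ π ⟩
      orthogonal : ∀ {v} → v ∈⟨ π ⟩ → Bf (pvec P) v ≡ 0#
      meets-Π₂   : ∀ {v} → v ∈⟨ π ⟩ → InΠ₂ v → Σ Carrier λ a → ∀ j → v j ≡ a * pvec P j

  module _ {P π} (π-at-P : PlaneAt P π) where
    open PlaneAt π-at-P

    Π₂-meets-plane-at : MeetInAtMostAPoint Π₂basis π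
    Π₂-meets-plane-at v w v∈Π₂ v∈π w∈Π₂ w∈π _ w≢0 =
      multiples-proportional (proj₂ (meets-Π₂ v∈π (∈Π₂basis⇒InΠ₂ v∈Π₂))) (proj₂ (meets-Π₂ w∈π (∈Π₂basis⇒InΠ₂ w∈Π₂))) w≢0

    plane-at-meets-Π₂ : MeetInAtMostAPoint π Π₂basis
    plane-at-meets-Π₂ v w v∈π v∈Π₂ w∈π w∈Π₂ = Π₂-meets-plane-at v w v∈Π₂ v∈π w∈Π₂ w∈π

    Π₂-≠-plane-at : ¬ SameSpan Π₂basis π
    Π₂-≠-plane-at same =
      pvec-nonzero (other P) (multiple-of-two-points⇒zero (other≢ P ∘ sym) (proj₂ other∈⟨P⟩) (λ j → sym (*-identityˡ _)))
      where
      other∈⟨P⟩ : Σ Carrier λ a → ∀ j → pvec (other P) j ≡ a * pvec P j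
      other∈⟨P⟩ = meets-Π₂ (proj₁ (same (pvec (other P))) (InΠ₂⇒∈Π₂basis (pvec∈Π₂ (other P)))) (pvec∈Π₂ (other P))

  module _ {P P′ π π′} (P≢P′ : P ≢ P′) (π-at-P : PlaneAt P π) (π′-at-P′ : PlaneAt P′ π′) where
    private
      module π = PlaneAt π-at-P
      module π′ = PlaneAt π′-at-P′

    planes-at-distinct-points-differ : ¬ SameSpan π π′
    planes-at-distinct-points-differ same with π′.meets-Π₂ (proj₁ (same (pvec P)) π.through) (pvec∈Π₂ P)
    ... | a , P≡aP′ = pvec-nonzero P (multiple-of-two-points⇒zero P≢P′ (λ j → sym (*-identityˡ _)) P≡aP′)

    planes-at-distinct-points-meet : MeetInAtMostAPoint π π′
    planes-at-distinct-points-meet v u v∈π v∈π′ u∈π u∈π′ _ u≢0 = combine backs-dependent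
      where
      backs-dependent : Dependent (back v) (back u)
      backs-dependent = ⊥-independent-pair⇒dependent (distinct-points-independent P≢P′)
        (back⊥point P v (π.orthogonal v∈π)) (back⊥point P′ v (π′.orthogonal v∈π′))
        (back⊥point P u (π.orthogonal u∈π)) (back⊥point P′ u (π′.orthogonal u∈π′))
      combine : Dependent (back v) (back u) → ∃[ c ] (∀ j → v j ≡ c * u j)
      combine (c₁ , c₂ , nontrivial , back-rel) = dependent⇒proportional nontrivial
        (multiple-of-two-points⇒zero P≢P′ (proj₂ (π.meets-Π₂ (∈-combine {b = π} v∈π u∈π c₁ c₂) back-rel))
                                          (proj₂ (π′.meets-Π₂ (∈-combine {b = π′} v∈π′ u∈π′ c₁ c₂) back-rel)))
        u≢0

  -- The planes ⟨P, ℓ⟩ of one spread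

  module SpreadPlanes {P : Pt2} {s : Fin 4 → V} {m : ℕ} {L : Fin m → Fin 2 → V}
                      (good : GoodSolid (pvec P) s) (spread : IsLineSpread s L) where
    private
      p : V
      p = pvec P

    plane : Fin m → Fin 3 → V
    plane k = joinPL p (L k)

    line-independent : ∀ k → LinIndep (L k)
    line-independent = proj₁ spread

    line⊆Σ : ∀ k {v} → v ∈⟨ L k ⟩ → v ∈⟨ s ⟩
    line⊆Σ k = span-⊆ {b = s} {b′ = L k} (proj₁ (proj₂ spread) k)

    lines-disjoint : ∀ k k′ → k ≢ k′ → ∀ v → v ∈⟨ L k ⟩ → v ∈⟨ L k′ ⟩ → IsZero v
    lines-disjoint = proj₁ (proj₂ (proj₂ (proj₂ spread)))

    Σ⊥p : ∀ {v} → v ∈⟨ s ⟩ → Bf p v ≡ 0#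
    Σ⊥p = Bf-∈ {b = s} p (proj₁ (proj₂ good))

    multiple-of-p∈Σ⇒zero : ∀ a → (λ j → a * p j) ∈⟨ s ⟩ → a ≡ 0#
    multiple-of-p∈Σ⇒zero a ap∈Σ with a ≟ 0#
    ... | yes a≡0 = a≡0
    ... | no a≢0 with ∃-inverseˡ a≢0
    ... | a⁻¹ , y≡a⁻¹ay = ⊥-elim (proj₂ (proj₂ good) (∈-resp-≗ {b = s} (sym ∘ y≡a⁻¹ay ∘ p) (∈-scale {b = s} ap∈Σ a⁻¹)))

    plane-decomposition : ∀ k {v} → v ∈⟨ plane k ⟩ →
                          Σ Carrier λ a → Σ V λ w → w ∈⟨ L k ⟩ × (∀ j → v j ≡ a * p j + w j)
    plane-decomposition k (c , v≡) = c 0F , lincomb (c ∘ suc) (L k) , (c ∘ suc , λ j → refl) , v≡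

    p∈plane : ∀ k → p ∈⟨ plane k ⟩
    p∈plane k = basis-∈ (plane k) 0F

    plane∩Σ⊆line : ∀ k {v} → v ∈⟨ plane k ⟩ → v ∈⟨ s ⟩ → v ∈⟨ L k ⟩
    plane∩Σ⊆line k {v} v∈plane v∈Σ with plane-decomposition k v∈plane
    ... | a , w , w∈ℓ , v≡ = ∈-resp-≗ {b = L k} w≡v w∈ℓ
      where
      a≡0 : a ≡ 0#
      a≡0 = multiple-of-p∈Σ⇒zero a (∈-resp-≗ {b = s} (λ j → trans (cong (_- w j) (v≡ j))
              (solve 3 (λ a x y → (a :* x :+ y) :- y := a :* x) refl a (p j) (w j))) (∈-sub {b = s} v∈Σ (line⊆Σ k w∈ℓ)))
      w≡v : ∀ j → w j ≡ v j
      w≡v j = begin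
        w j             ≡⟨ solve 2 (λ x y → y := con (0 , 0) :* x :+ y) refl (p j) (w j) ⟩
        0# * p j + w j  ≡⟨ cong (λ α → α * p j + w j) (sym a≡0) ⟩
        a * p j + w j   ≡⟨ sym (v≡ j) ⟩
        v j             ∎

    plane-basis⊥p : ∀ k i → Bf p (plane k i) ≡ 0#
    plane-basis⊥p k 0F = Bf-alternating p
    plane-basis⊥p k 1F = Σ⊥p (proj₁ (proj₂ spread) k 0F)
    plane-basis⊥p k 2F = Σ⊥p (proj₁ (proj₂ spread) k 1F)

    plane⊥p : ∀ k {v} → v ∈⟨ plane k ⟩ → Bf p v ≡ 0#
    plane⊥p k = Bf-∈ {b = plane k} p (plane-basis⊥p k)

    plane-independent : ∀ k → LinIndep (plane k)
    plane-independent k c c≡0 = λ where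
        0F → c₀≡0
        (suc i) → line-independent k (c ∘ suc) w≡0 i
      where
      w : V
      w = lincomb (c ∘ suc) (L k)
      c₀≡0 : c 0F ≡ 0#
      c₀≡0 = multiple-of-p∈Σ⇒zero (c 0F) (∈-resp-≗ {b = s} (λ j → begin
        - 1# * w j                           ≡⟨ solve 2 (λ a y → :- con (1 , 0) :* y := a :- (a :+ y)) refl (c 0F * p j) (w j) ⟩
        c 0F * p j - (c 0F * p j + w j)      ≡⟨ cong (λ z → c 0F * p j - z) (c≡0 j) ⟩
        c 0F * p j - 0#                      ≡⟨ solve 1 (λ a → a :- con (0 , 0) := a) refl _ ⟩
        c 0F * p j                           ∎) (∈-scale {b = s} (line⊆Σ k (c ∘ suc , λ j → refl)) (- 1#)))
      w≡0 : ∀ j → w j ≡ 0#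
      w≡0 j = trans (solve 2 (λ x y → y := con (0 , 0) :* x :+ y) refl (p j) (w j))
                    (trans (cong (λ α → α * p j + w j) (sym c₀≡0)) (c≡0 j))

    plane-isotropic : ∀ k → TotIsotropic (plane k)
    plane-isotropic k 0F j = plane-basis⊥p k j
    plane-isotropic k 1F 0F = Bf-sym-zero p (L k 0F) (plane-basis⊥p k 1F)
    plane-isotropic k 2F 0F = Bf-sym-zero p (L k 1F) (plane-basis⊥p k 2F)
    plane-isotropic k 1F 1F = proj₁ (proj₂ (proj₂ spread)) k 0F 0F
    plane-isotropic k 1F 2F = proj₁ (proj₂ (proj₂ spread)) k 0F 1F
    plane-isotropic k 2F 1F = proj₁ (proj₂ (proj₂ spread)) k 1F 0F
    plane-isotropic k 2F 2F = proj₁ (proj₂ (proj₂ spread)) k 1F 1F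

    plane-generator : ∀ k → IsGenerator (plane k)
    plane-generator k = plane-independent k , plane-isotropic k

    plane∩plane⊆⟨p⟩ : ∀ {k k′} → k ≢ k′ → ∀ {v} → v ∈⟨ plane k ⟩ → v ∈⟨ plane k′ ⟩ →
                      Σ Carrier λ a → ∀ j → v j ≡ a * p j
    plane∩plane⊆⟨p⟩ {k} {k′} k≢k′ {v} v∈k v∈k′ with plane-decomposition k v∈k
    ... | a , w , w∈ℓ , v≡ = a , λ j → trans (v≡ j) (trans (cong (a * p j +_) (w≡0 j)) (+-identityʳ _))
      where
      w∈plane′ : w ∈⟨ plane k′ ⟩
      w∈plane′ = ∈-resp-≗ {b = plane k′} (λ j → trans (cong (_- a * p j) (v≡ j))
                   (solve 3 (λ a x y → (a :* x :+ y) :- a :* x := y) refl a (p j) (w j)))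
                   (∈-sub {b = plane k′} v∈k′ (∈-scale {b = plane k′} (p∈plane k′) a))
      w≡0 : IsZero w
      w≡0 = lines-disjoint k k′ k≢k′ w w∈ℓ (plane∩Σ⊆line k′ w∈plane′ (line⊆Σ k w∈ℓ))

    planes-meet-in-p : ∀ {k k′} → k ≢ k′ → MeetInAtMostAPoint (plane k) (plane k′)
    planes-meet-in-p k≢k′ v w v∈k v∈k′ w∈k w∈k′ _ w≢0 =
      multiples-proportional (proj₂ (plane∩plane⊆⟨p⟩ k≢k′ v∈k v∈k′)) (proj₂ (plane∩plane⊆⟨p⟩ k≢k′ w∈k w∈k′)) w≢0

    line-basis∉other-line : ∀ {k k′} → k ≢ k′ → ¬ (L k 0F ∈⟨ L k′ ⟩)
    line-basis∉other-line {k} {k′} k≢k′ ℓ∈k′ =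
      independent⇒nonzero {b = L k} (line-independent k) 0F (lines-disjoint k k′ k≢k′ _ (basis-∈ (L k) 0F) ℓ∈k′)

    planes-distinct : ∀ {k k′} → k ≢ k′ → ¬ SameSpan (plane k) (plane k′)
    planes-distinct {k} {k′} k≢k′ same = line-basis∉other-line k≢k′
      (plane∩Σ⊆line k′ (proj₁ (same (L k 0F)) (basis-∈ (plane k) 1F)) (line⊆Σ k (basis-∈ (L k) 0F)))

    span-determines-line : ∀ {k k′} {T : V → Set} → SpanIs (L k) T → SpanIs (L k′) T → k ≡ k′
    span-determines-line {k} {k′} spans spans′ with k Fin.≟ k′
    ... | yes k≡k′ = k≡k′
    ... | no k≢k′ = ⊥-elim (line-basis∉other-line k≢k′ (proj₂ (spans′ _) (proj₁ (spans _) (basis-∈ (L k) 0F))))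

    r≢t : ∀ {kr kt} → SpanIs (L kr) (rSet s) → SpanIs (L kt) (tSet s) → kr ≢ kt
    r≢t {kr} r-spans t-spans refl = independent⇒nonzero {b = L kr} (line-independent kr) 0F
      (Π₁∩Π₂≡0 {L kr 0F} (proj₂ (proj₁ (r-spans _) (basis-∈ (L kr) 0F)))
                          (proj₂ (proj₁ (t-spans _) (basis-∈ (L kr) 0F))))

    plane∩Π₂⊆⟨p⟩ : ∀ {kt} → SpanIs (L kt) (tSet s) → ∀ {k} → k ≢ kt →
                   ∀ {v} → v ∈⟨ plane k ⟩ → InΠ₂ v → Σ Carrier λ a → ∀ j → v j ≡ a * p j
    plane∩Π₂⊆⟨p⟩ {kt} t-spans {k} k≢kt {v} v∈plane v∈Π₂ with plane-decomposition k v∈plane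
    ... | a , w , w∈ℓ , v≡ = a , λ j → trans (v≡ j) (trans (cong (a * p j +_) (w≡0 j)) (+-identityʳ _))
      where
      w∈Π₂ : InΠ₂ w
      w∈Π₂ i = begin
        w (3 ↑ʳ i)                          ≡⟨ solve 3 (λ a x y → y := (a :* x :+ y) :- a :* x) refl a _ _ ⟩
        (a * p (3 ↑ʳ i) + w (3 ↑ʳ i)) - a * p (3 ↑ʳ i)  ≡⟨ cong₂ (λ x y → x - a * y)
                                                              (trans (sym (v≡ _)) (v∈Π₂ i)) (pvec∈Π₂ P i) ⟩
        0# - a * 0#                         ≡⟨ solve 1 (λ a → con (0 , 0) :- a :* con (0 , 0) := con (0 , 0)) refl a ⟩
        0#                                  ∎
      w≡0 : IsZero w
      w≡0 = lines-disjoint k kt k≢kt w w∈ℓ (proj₂ (t-spans w) (line⊆Σ k w∈ℓ , w∈Π₂))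

    plane-at-P : ∀ {kt} → SpanIs (L kt) (tSet s) → ∀ {k} → k ≢ kt → PlaneAt P (plane k)
    plane-at-P t-spans {k} k≢kt = record
      { through = p∈plane k ; orthogonal = plane⊥p k ; meets-Π₂ = plane∩Π₂⊆⟨p⟩ t-spans k≢kt }

    -- P^⊥ ∩ Π₁ is a line (⊥-nonzero⇒∈span) containing r = Σ ∩ Π₁, hence equal to it;
    -- so plane k ∩ Π₁ ⊆ plane k ∩ Σ ∩ r = ℓ_k ∩ r = 0.
    plane-disjoint-Π₁ : ∀ {kr} → SpanIs (L kr) (rSet s) → ∀ {k} → k ≢ kr → DisjointFromΠ₁ (plane k)
    plane-disjoint-Π₁ {kr} r-spans {k} k≢kr v v∈plane v∈Π₁ =
      lines-disjoint k kr k≢kr v (plane∩Σ⊆line k v∈plane (line⊆Σ kr v∈r)) v∈r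
      where
      r : Fin 2 → V
      r = L kr

      r∈Π₁ : ∀ i → InΠ₁ (r i)
      r∈Π₁ i = proj₂ (proj₁ (r-spans (r i)) (basis-∈ r i))

      backs-independent : ¬ Dependent (back (r 0F)) (back (r 1F))
      backs-independent (a , b , nontrivial , back-rel) =
        [ (λ a≢0 → a≢0 (coefficient≡0 0F)) , (λ b≢0 → b≢0 (coefficient≡0 1F)) ]′ nontrivial
        where
        coefficient≡0 : ∀ i → pair a b i ≡ 0#
        coefficient≡0 = line-independent kr (pair a b) λ j →
          sym (Π₁-line-combination {λ _ → 0#} {r} a b (λ _ → refl) r∈Π₁ (λ i → sym (back-rel i)) j)

      v∈r : v ∈⟨ r ⟩
      v∈r = from-span (⊥-nonzero⇒∈span {point P} {back (r 0F)} {back (r 1F)} {back v}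
              (proj₁ (point-nonzero P)) (proj₂ (point-nonzero P)) backs-independent
              (back⊥point P (r 0F) (plane-basis⊥p kr 1F)) (back⊥point P (r 1F) (plane-basis⊥p kr 2F))
              (back⊥point P v (plane⊥p k v∈plane)))
        where
        from-span : (Σ Carrier λ α → Σ Carrier λ β → ∀ i → back v i ≡ α * back (r 0F) i + β * back (r 1F) i) →
                    v ∈⟨ r ⟩
        from-span (α , β , back≡) = pair α β , Π₁-line-combination {v} {r} α β v∈Π₁ r∈Π₁ back≡

-- Counting

record Complement₂ {M : ℕ} (a b : Fin M) (n : ℕ) : Set where
  field
    index     : Fin n → Fin M
    injective : ∀ {j j′} → index j ≡ index j′ → j ≡ j′
    avoids-a  : ∀ j → index j ≢ a
    avoids-b  : ∀ j → index j ≢ b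
    onto      : ∀ k → k ≢ a → k ≢ b → ∃[ j ] index j ≡ k

complement₂ : ∀ {M n} → M ≡ suc (suc n) → {a b : Fin M} → a ≢ b → Complement₂ a b n
complement₂ refl {a} {b} a≢b = record
  { index = index
  ; injective = λ e → punchIn-injective b′ _ _ (punchIn-injective a _ _ e)
  ; avoids-a = λ j → punchInᵢ≢i a _
  ; avoids-b = λ j e → punchInᵢ≢i b′ j (punchIn-injective a _ _ (trans e (sym (punchIn-punchOut a≢b))))
  ; onto = λ k k≢a k≢b → punchOut (b′≢k′ k k≢a k≢b) , trans (cong (punchIn a) (punchIn-punchOut _)) (punchIn-punchOut _)
  }
  where
  b′ = punchOut a≢b
  index : Fin _ → Fin _
  index j = punchIn a (punchIn b′ j)
  b′≢k′ : ∀ k (k≢a : k ≢ a) → k ≢ b → b′ ≢ punchOut (k≢a ∘ sym)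
  b′≢k′ k k≢a k≢b e = k≢b (trans (sym (punchIn-punchOut (k≢a ∘ sym)))
                         (trans (cong (punchIn a) (sym e)) (punchIn-punchOut a≢b)))

×-distribˡ-⊤⊎ : ∀ {A B : Set} → (A × (⊤ ⊎ B)) ↔ (A ⊎ (A × B))
×-distribˡ-⊤⊎ = mk↔ₛ′ (λ { (a , inj₁ _) → inj₁ a ; (a , inj₂ b) → inj₂ (a , b) })
                      (λ { (inj₁ a) → a , inj₁ tt ; (inj₂ (a , b)) → a , inj₂ b })
                      (λ { (inj₁ _) → refl ; (inj₂ _) → refl })
                      (λ { (_ , inj₁ tt) → refl ; (_ , inj₂ _) → refl })

module Arithmetic where
  open import Data.Nat using (_+_; _*_; _∸_; _^_; _<_; s≤s; z≤n)
  open import Data.Nat.Properties using (+-cancelˡ-≡; *-cancelʳ-≡; suc-injective)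
  open import Data.Nat.Tactic.RingSolver using (solve; solve-∀)
  open import Data.List using (_∷_; [])

  spread-size : ∀ Q m → 1 < Q → Q * Q + m ≡ 1 + m * Q → m ≡ suc Q
  spread-size (suc (suc r)) m (s≤s (s≤s z≤n)) count =
    sym (*-cancelʳ-≡ (3 + r) m (suc r) (suc-injective (+-cancelˡ-≡ m _ _ (begin
    m + suc ((3 + r) * suc r)      ≡⟨ solve (m ∷ r ∷ []) ⟩
    suc (suc r) * suc (suc r) + m  ≡⟨ count ⟩
    1 + m * suc (suc r)            ≡⟨ solve (m ∷ r ∷ []) ⟩
    m + suc (m * suc r)            ∎))))
    where open ≡-Reasoning

  private
    cube : ∀ q → suc q * (suc q * (suc q * 1)) ≡ suc (q * q * q + 3 * q * q + 3 * q)
    cube = solve-∀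
    square : ∀ q → suc q * suc q ≡ suc (q * q + 2 * q)
    square = solve-∀
    factorise : ∀ q → (suc q + 1) * (q * q * q + 3 * q * q + 3 * q) + 1 ≡ suc ((suc q * suc q + (suc q + 1)) * (q * q + 2 * q))
    factorise = solve-∀

  total-size : ∀ q → (suc q + 1) * (suc q ^ 3 ∸ 1) + 1 ≡ suc ((suc q * suc q + (suc q + 1)) * (suc q * suc q ∸ 1))
  total-size q = begin
    (suc q + 1) * (suc q ^ 3 ∸ 1) + 1                          ≡⟨ cong (λ c → (suc q + 1) * (c ∸ 1) + 1) (cube q) ⟩
    (suc q + 1) * (q * q * q + 3 * q * q + 3 * q) + 1          ≡⟨ factorise q ⟩
    suc ((suc q * suc q + (suc q + 1)) * (q * q + 2 * q))      ≡⟨ cong (λ c → suc ((suc q * suc q + (suc q + 1)) * (c ∸ 1)))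
                                                                       (sym (square q)) ⟩
    suc ((suc q * suc q + (suc q + 1)) * (suc q * suc q ∸ 1))  ∎
    where open ≡-Reasoning

open Arithmetic

module Counting (F : FiniteField) where
  open FiniteField F using (Carrier; _≟_; q; enum; 0≢1; isCommutativeRing)
  open Geometry F
  open LinearAlgebra F
  open CommutativeRingSolver isCommutativeRing using (commutativeRing; solve; _:=_; _:+_; _:*_; con)
  open CommutativeRing commutativeRing using (_+_; _*_; 0#; 1#)

  record NonZeroPair : Set where
    constructor nonzeroPair
    field
      first second : Carrier
      .nonzero     : ¬ (first ≡ 0# × second ≡ 0#)

  nonzeroPair-≡ : ∀ {a a′ b b′} .{p p′} → a ≡ a′ → b ≡ b′ → nonzeroPair a b p ≡ nonzeroPair a′ b′ p′
  nonzeroPair-≡ refl refl = refl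

  pairs↔ : (Carrier × Carrier) ↔ (⊤ ⊎ NonZeroPair)
  pairs↔ = mk↔ₛ′ to from to∘from from∘to
    where
    classify : ∀ a b → Dec (a ≡ 0# × b ≡ 0#) → ⊤ ⊎ NonZeroPair
    classify a b (yes _) = inj₁ tt
    classify a b (no ab≢0) = inj₂ (nonzeroPair a b ab≢0)
    to : Carrier × Carrier → ⊤ ⊎ NonZeroPair
    to (a , b) = classify a b ((a ≟ 0#) ×-dec (b ≟ 0#))
    from : ⊤ ⊎ NonZeroPair → Carrier × Carrier
    from (inj₁ _) = 0# , 0#
    from (inj₂ (nonzeroPair a b _)) = a , b
    to∘from : ∀ x → to (from x) ≡ x
    to∘from (inj₁ tt) with (0# ≟ 0#) ×-dec (0# ≟ 0#)
    ... | yes _ = refl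
    ... | no 0≢0 = ⊥-elim (0≢0 (refl , refl))
    to∘from (inj₂ (nonzeroPair a b ab≢0)) with (a ≟ 0#) ×-dec (b ≟ 0#)
    ... | yes ab≡0 = Irrelevant.⊥-elim (ab≢0 ab≡0)
    ... | no _ = refl
    from∘to : ∀ x → from (to x) ≡ x
    from∘to (a , b) with (a ≟ 0#) ×-dec (b ≟ 0#)
    ... | yes (a≡0 , b≡0) = cong₂ _,_ (sym a≡0) (sym b≡0)
    ... | no _ = refl

  Quadruple : Set
  Quadruple = (Carrier × Carrier) × (Carrier × Carrier)

  entries : Quadruple → Fin 4 → Carrier
  entries ((a , b) , (c , d)) 0F = a
  entries ((a , b) , (c , d)) 1F = b
  entries ((a , b) , (c , d)) 2F = c
  entries ((a , b) , (c , d)) 3F = d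

  quadruple : (Fin 4 → Carrier) → Quadruple
  quadruple f = (f 0F , f 1F) , (f 2F , f 3F)

  entries-quadruple : ∀ f i → entries (quadruple f) i ≡ f i
  entries-quadruple f 0F = refl
  entries-quadruple f 1F = refl
  entries-quadruple f 2F = refl
  entries-quadruple f 3F = refl

  quadruple-entries : ∀ {t f} → (∀ i → entries t i ≡ f i) → quadruple f ≡ t
  quadruple-entries {(a , b) , (c , d)} e = sym (cong₂ _,_ (cong₂ _,_ (e 0F) (e 1F)) (cong₂ _,_ (e 2F) (e 3F)))

  module _ {s : Fin 4 → V} {m} {L : Fin m → Fin 2 → V} (s-independent : LinIndep s) (spread : IsLineSpread s L) where
    private
      line-independent : ∀ k → LinIndep (L k)
      line-independent = proj₁ spread
      lines-disjoint : ∀ k k′ → k ≢ k′ → ∀ v → v ∈⟨ L k ⟩ → v ∈⟨ L k′ ⟩ → IsZero v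
      lines-disjoint = proj₁ (proj₂ (proj₂ (proj₂ spread)))
      lines-cover : ∀ v → v ∈⟨ s ⟩ → NonZero v → ∃[ k ] (v ∈⟨ L k ⟩)
      lines-cover = proj₂ (proj₂ (proj₂ (proj₂ spread)))

    vector : Quadruple → V
    vector t = lincomb (entries t) s

    line-vector : Fin m → NonZeroPair → V
    line-vector k (nonzeroPair a b _) = lincomb (pair a b) (L k)

    line-vector∈Σ : ∀ k x → line-vector k x ∈⟨ s ⟩
    line-vector∈Σ k (nonzeroPair a b _) = span-⊆ {b = s} {b′ = L k} (proj₁ (proj₂ spread) k) (pair a b , λ j → refl)

    vector-nonzero : ∀ t → ¬ (∀ i → entries t i ≡ 0#) → NonZero (vector t)
    vector-nonzero t t≢0 vt≡0 = t≢0 (s-independent (entries t) vt≡0)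

    covering : ∀ t → ¬ (∀ i → entries t i ≡ 0#) →
               Σ (Fin m × NonZeroPair) λ (k , x) → ∀ j → vector t j ≡ line-vector k x j
    covering t t≢0 with lines-cover (vector t) (entries t , λ j → refl) (vector-nonzero t t≢0)
    ... | k , d , vt≡ = (k , nonzeroPair (d 0F) (d 1F) d≢0) , vt≡
      where
      d≢0 : ¬ (d 0F ≡ 0# × d 1F ≡ 0#)
      d≢0 (d₀≡0 , d₁≡0) = vector-nonzero t t≢0 λ j → trans (vt≡ j)
        (trans (cong₂ (λ α β → α * L k 0F j + (β * L k 1F j + 0#)) d₀≡0 d₁≡0)
               (solve 2 (λ x y → con (0 , 0) :* x :+ (con (0 , 0) :* y :+ con (0 , 0)) := con (0 , 0)) refl _ _))

    classify : ∀ t → Dec (∀ i → entries t i ≡ 0#) → ⊤ ⊎ (Fin m × NonZeroPair)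
    classify t (yes _) = inj₁ tt
    classify t (no t≢0) = inj₂ (proj₁ (covering t t≢0))

    coordinates-of : ⊤ ⊎ (Fin m × NonZeroPair) → Quadruple
    coordinates-of (inj₁ _) = (0# , 0#) , (0# , 0#)
    coordinates-of (inj₂ (k , x)) = quadruple (proj₁ (line-vector∈Σ k x))

    vector-coordinates-of : ∀ k x j → vector (coordinates-of (inj₂ (k , x))) j ≡ line-vector k x j
    vector-coordinates-of k x j =
      trans (lincomb-cong s (entries-quadruple (proj₁ (line-vector∈Σ k x))) j) (sym (proj₂ (line-vector∈Σ k x) j))

    quadruples↔ : Quadruple ↔ (⊤ ⊎ (Fin m × NonZeroPair))
    quadruples↔ = mk↔ₛ′ to coordinates-of to∘from from∘to
      where
      to : Quadruple → ⊤ ⊎ (Fin m × NonZeroPair)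
      to t = classify t (all? (λ i → entries t i ≟ 0#))

      from∘to : ∀ t → coordinates-of (to t) ≡ t
      from∘to t with all? (λ i → entries t i ≟ 0#)
      ... | yes t≡0 = quadruple-entries {f = λ _ → 0#} t≡0
      ... | no t≢0 = quadruple-entries {f = proj₁ (line-vector∈Σ k x)} (lincomb-injective {b = s} s-independent λ j →
              trans (proj₂ (covering t t≢0) j) (proj₂ (line-vector∈Σ k x) j))
        where
        k = proj₁ (proj₁ (covering t t≢0))
        x = proj₂ (proj₁ (covering t t≢0))

      to∘from : ∀ y → to (coordinates-of y) ≡ y
      to∘from (inj₁ tt) with all? (λ i → entries ((0# , 0#) , (0# , 0#)) i ≟ 0#)
      ... | yes _ = refl
      ... | no ≢0 = ⊥-elim (≢0 λ where 0F → refl ; 1F → refl ; 2F → refl ; 3F → refl)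
      to∘from (inj₂ (k , nonzeroPair a b ab≢0))
        with all? (λ i → entries (coordinates-of (inj₂ (k , nonzeroPair a b ab≢0))) i ≟ 0#)
      ... | yes t≡0 = Irrelevant.⊥-elim (ab≢0 (coefficient≡0 0F , coefficient≡0 1F))
        where
        coefficient≡0 : ∀ i → pair a b i ≡ 0#
        coefficient≡0 = line-independent k (pair a b) λ j → trans (sym (vector-coordinates-of k (nonzeroPair a b ab≢0) j))
          (trans (lincomb-cong s t≡0 j) (lincomb-zero s j))
      ... | no t≢0 = cong inj₂ (same-line (covering _ t≢0))
        where
        t = coordinates-of (inj₂ (k , nonzeroPair a b ab≢0))
        same-line : (c : Σ (Fin m × NonZeroPair) λ (k′ , x′) → ∀ j → vector t j ≡ line-vector k′ x′ j) →
                    proj₁ c ≡ (k , nonzeroPair a b ab≢0)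
        same-line ((k′ , nonzeroPair a′ b′ _) , t≡) with k′ Fin.≟ k
        ... | no k′≢k = ⊥-elim (vector-nonzero t t≢0
                          (lines-disjoint k′ k k′≢k (vector t) (pair a′ b′ , t≡)
                                          (pair a b , vector-coordinates-of k (nonzeroPair a b ab≢0))))
        ... | yes refl = cong (k ,_) (nonzeroPair-≡ (same-coefficients 0F) (same-coefficients 1F))
          where
          same-coefficients : ∀ i → pair a′ b′ i ≡ pair a b i
          same-coefficients = lincomb-injective {b = L k} (line-independent k) {pair a′ b′} {pair a b}
            λ j → trans (sym (t≡ j)) (vector-coordinates-of k (nonzeroPair a b ab≢0) j)

  field-size : ∃[ r ] q ≡ suc (suc r)
  field-size = at-least-two (Inverse.from enum 0#) (Inverse.from enum 1#) λ e →
    0≢1 (trans (sym (Inverse.strictlyInverseˡ enum 0#)) (trans (cong (Inverse.to enum) e) (Inverse.strictlyInverseˡ enum 1#)))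
    where
    at-least-two : ∀ {n} (a b : Fin n) → a ≢ b → ∃[ r ] n ≡ suc (suc r)
    at-least-two {suc zero} zero zero a≢b = ⊥-elim (a≢b refl)
    at-least-two {suc (suc r)} _ _ _ = r , refl

  pairs-size : Fin (q ℕ.* q) ↔ (Carrier × Carrier)
  pairs-size = ↔-trans *↔× (enum ×-↔ enum)

  1<q*q : 1 ℕ.< q ℕ.* q
  1<q*q with field-size
  ... | r , q≡2+r rewrite q≡2+r = ℕ.s≤s (ℕ.s≤s ℕ.z≤n)

  lines-per-point : ℕ
  lines-per-point = q ℕ.* q ℕ.∸ 1

  q*q≡1+lines-per-point : q ℕ.* q ≡ suc lines-per-point
  q*q≡1+lines-per-point with field-size
  ... | r , q≡2+r rewrite q≡2+r = refl

  -- Opaque because the enumeration of the lines of each spread is transported along this equation: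
  -- unfolding it would make Agda evaluate the counting bijections.
  opaque
    spread-count : ∀ {s m} {L : Fin m → Fin 2 → V} → LinIndep s → IsLineSpread s L → m ≡ suc (suc lines-per-point)
    spread-count {s} {m} s-independent spread = trans (spread-size (q ℕ.* q) m 1<q*q (↔⇒≡ (begin
      Fin (Q ℕ.* Q ℕ.+ m)                                   ↔⟨ +↔⊎ ⟩
      (Fin (Q ℕ.* Q) ⊎ Fin m)                               ↔⟨ ↔-trans *↔× (pairs-size ×-↔ pairs-size) ⊎-↔ ↔-refl ⟩
      (Quadruple ⊎ Fin m)                                   ↔⟨ quadruples↔ {s = s} s-independent spread ⊎-↔ ↔-refl ⟩
      ((⊤ ⊎ (Fin m × NonZeroPair)) ⊎ Fin m)                 ↔⟨ ⊎-assoc 0ℓ _ _ _ ⟩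
      (⊤ ⊎ ((Fin m × NonZeroPair) ⊎ Fin m))                 ↔⟨ ↔-refl ⊎-↔ ⊎-comm _ _ ⟩
      (⊤ ⊎ (Fin m ⊎ (Fin m × NonZeroPair)))                 ↔⟨ ↔-refl ⊎-↔ ↔-sym ×-distribˡ-⊤⊎ ⟩
      (⊤ ⊎ (Fin m × (⊤ ⊎ NonZeroPair)))                     ↔⟨ ↔-sym 1↔⊤ ⊎-↔ (↔-refl ×-↔ ↔-sym (↔-trans pairs-size pairs↔)) ⟩
      (Fin 1 ⊎ (Fin m × Fin Q))                             ↔⟨ ↔-sym (↔-trans +↔⊎ (↔-refl ⊎-↔ *↔×)) ⟩
      Fin (1 ℕ.+ m ℕ.* Q)                                   ∎))) (cong suc q*q≡1+lines-per-point)
      where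
      Q : ℕ
      Q = q ℕ.* q
      open EquationalReasoning

  points↔ : Fin (q ℕ.* q ℕ.+ (q ℕ.+ 1)) ↔ Pt2
  points↔ = ↔-trans +↔⊎ (↔-trans (pairs-size ⊎-↔ ↔-trans +↔⊎ (enum ⊎-↔ 1↔⊤)) normalised)
    where
    normalised : ((Carrier × Carrier) ⊎ (Carrier ⊎ ⊤)) ↔ Pt2
    normalised = mk↔ₛ′ (λ { (inj₁ (a , b)) → pt-a a b ; (inj₂ (inj₁ a)) → pt-b a ; (inj₂ (inj₂ _)) → pt-c })
                       (λ { (pt-a a b) → inj₁ (a , b) ; (pt-b a) → inj₂ (inj₁ a) ; pt-c → inj₂ (inj₂ tt) })
                       (λ { (pt-a _ _) → refl ; (pt-b _) → refl ; pt-c → refl })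
                       (λ { (inj₁ _) → refl ; (inj₂ (inj₁ _)) → refl ; (inj₂ (inj₂ tt)) → refl })

  opaque
    planes-count : (q ℕ.+ 1) ℕ.* (q ℕ.^ 3 ℕ.∸ 1) ℕ.+ 1 ≡ suc ((q ℕ.* q ℕ.+ (q ℕ.+ 1)) ℕ.* lines-per-point)
    planes-count with field-size
    ... | r , q≡2+r rewrite q≡2+r = total-size (suc r)

  planes↔ : Fin ((q ℕ.+ 1) ℕ.* (q ℕ.^ 3 ℕ.∸ 1) ℕ.+ 1) ↔ (⊤ ⊎ (Pt2 × Fin lines-per-point))
  planes↔ = subst (λ n → Fin n ↔ (⊤ ⊎ (Pt2 × Fin lines-per-point))) (sym planes-count)
    (↔-trans +↔⊎ (1↔⊤ ⊎-↔ ↔-trans *↔× (points↔ ×-↔ ↔-refl)))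

module PlanesOfX (F : FiniteField) where
  open FiniteField F using (q)
  open Geometry F
  open LinearAlgebra F
  open Counting F

  module Properties (S : Pt2 → Fin 4 → V) (m : Pt2 → ℕ) (L : (P : Pt2) → Fin (m P) → Fin 2 → V)
      (good : ∀ P → GoodSolid (pvec P) (S P)) (spread : ∀ P → IsLineSpread (S P) (L P))
      (r-line : ∀ P → ∃[ k ] SpanIs (L P k) (rSet (S P))) (t-line : ∀ P → ∃[ k ] SpanIs (L P k) (tSet (S P))) where
    open Construction S m L
    module At (P : Pt2) = SpreadPlanes {P} {S P} {m P} {L P} (good P) (spread P)

    kr kt : ∀ P → Fin (m P)
    kr P = proj₁ (r-line P)
    kt P = proj₁ (t-line P)

    ≢kr : ∀ {P k} → ¬ SpanIs (L P k) (rSet (S P)) → k ≢ kr P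
    ≢kr {P} not-r refl = not-r (proj₂ (r-line P))

    ≢kt : ∀ {P k} → ¬ SpanIs (L P k) (tSet (S P)) → k ≢ kt P
    ≢kt {P} not-t refl = not-t (proj₂ (t-line P))

    plane-at : ∀ P {k} → k ≢ kt P → PlaneAt P (At.plane P k)
    plane-at P = At.plane-at-P P (proj₂ (t-line P))

    generator : ∀ x → IsGenerator (plane x)
    generator (inj₁ _) = Π₂-generator
    generator (inj₂ (P , k , _)) = At.plane-generator P k

    disjoint : ∀ x → DisjointFromΠ₁ (plane x)
    disjoint (inj₁ _) = Π₂-disjoint-Π₁
    disjoint (inj₂ (P , k , not-r , _)) = At.plane-disjoint-Π₁ P (proj₂ (r-line P)) (≢kr not-r)

    meet : ∀ x y → ¬ SameSpan (plane x) (plane y) → MeetInAtMostAPoint (plane x) (plane y)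
    meet (inj₁ _) (inj₁ _) different = ⊥-elim (different (SameSpan-refl Π₂basis))
    meet (inj₁ _) (inj₂ (P , k , _ , not-t)) _ = Π₂-meets-plane-at (plane-at P (≢kt not-t))
    meet (inj₂ (P , k , _ , not-t)) (inj₁ _) _ = plane-at-meets-Π₂ (plane-at P (≢kt not-t))
    meet (inj₂ (P , k , _ , not-t)) (inj₂ (P′ , k′ , _ , not-t′)) different with P ≟ₚ P′
    ... | no P≢P′ = planes-at-distinct-points-meet P≢P′ (plane-at P (≢kt not-t)) (plane-at P′ (≢kt not-t′))
    ... | yes refl with k Fin.≟ k′
    ...   | yes refl = ⊥-elim (different (SameSpan-refl (At.plane P k)))
    ...   | no k≢k′ = At.planes-meet-in-p P k≢k′

    other-lines : ∀ P → Complement₂ (kr P) (kt P) lines-per-point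
    other-lines P = complement₂ (spread-count {S P} {m P} {L P} (proj₁ (good P)) (spread P))
                                (At.r≢t P (proj₂ (r-line P)) (proj₂ (t-line P)))

    listed-plane-at : ∀ P j → PlaneAt P (At.plane P (Complement₂.index (other-lines P) j))
    listed-plane-at P j = plane-at P (Complement₂.avoids-b (other-lines P) j)

    x-of : ⊤ ⊎ (Pt2 × Fin lines-per-point) → XIndex
    x-of (inj₁ _) = inj₁ tt
    x-of (inj₂ (P , j)) = inj₂ (P , index j ,
        (λ spans → avoids-a j (At.span-determines-line P spans (proj₂ (r-line P)))) ,
        (λ spans → avoids-b j (At.span-determines-line P spans (proj₂ (t-line P)))))
      where open Complement₂ (other-lines P)

    x-of-distinct : ∀ c c′ → c ≢ c′ → ¬ SameSpan (plane (x-of c)) (plane (x-of c′))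
    x-of-distinct (inj₁ tt) (inj₁ tt) c≢c′ = ⊥-elim (c≢c′ refl)
    x-of-distinct (inj₁ _) (inj₂ (P , j)) _ = Π₂-≠-plane-at (listed-plane-at P j)
    x-of-distinct (inj₂ (P , j)) (inj₁ _) _ =
      Π₂-≠-plane-at (listed-plane-at P j) ∘ SameSpan-sym {b = At.plane P _} {b′ = Π₂basis}
    x-of-distinct (inj₂ (P , j)) (inj₂ (P′ , j′)) c≢c′ with P ≟ₚ P′
    ... | no P≢P′ = planes-at-distinct-points-differ P≢P′ (listed-plane-at P j) (listed-plane-at P′ j′)
    ... | yes refl = At.planes-distinct P (c≢c′ ∘ cong (λ j → inj₂ (P , j)) ∘ Complement₂.injective (other-lines P))

    x-of-complete : ∀ x → ∃[ c ] SameSpan (plane x) (plane (x-of c))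
    x-of-complete (inj₁ tt) = inj₁ tt , SameSpan-refl Π₂basis
    x-of-complete (inj₂ (P , k , not-r , not-t)) with Complement₂.onto (other-lines P) k (≢kr not-r) (≢kt not-t)
    ... | j , refl = inj₂ (P , j) , SameSpan-refl (At.plane P k)

    enumeration : Σ (Fin ((q ℕ.+ 1) ℕ.* (q ℕ.^ 3 ℕ.∸ 1) ℕ.+ 1) → XIndex) λ e →
                      (∀ i j → i ≢ j → ¬ SameSpan (plane (e i)) (plane (e j)))
                    × (∀ x → ∃[ i ] SameSpan (plane x) (plane (e i)))
    enumeration = x-of ∘ to , distinct , complete
      where
      open Inverse planes↔ using (to; from; strictlyInverseˡ)
      distinct : ∀ i j → i ≢ j → ¬ SameSpan (plane (x-of (to i))) (plane (x-of (to j)))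
      distinct i j i≢j = x-of-distinct _ _ (i≢j ∘ Injection.injective (↔⇒↣ planes↔))
      complete : ∀ x → ∃[ i ] SameSpan (plane x) (plane (x-of (to i)))
      complete x with x-of-complete x
      ... | c , same = from c , subst (λ c′ → SameSpan (plane x) (plane (x-of c′))) (sym (strictlyInverseˡ c)) same

open import Data.Nat using (ℕ; _+_; _*_; _∸_; _^_)
open import Data.Fin using (Fin)
open import Data.Product using (Σ; ∃-syntax; _×_)
open import Relation.Nullary using (¬_)
open import Relation.Binary.PropositionalEquality using (_≢_)

mainTheorem8 : (F : FiniteField) → let open Geometry F in
    (S : Pt2 → Fin 4 → V) → (m : Pt2 → ℕ) → (L : (P : Pt2) → Fin (m P) → Fin 2 → V) →
    (∀ P → GoodSolid (pvec P) (S P)) →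
    (∀ P → IsLineSpread (S P) (L P)) →
    (∀ P → ∃[ k ] SpanIs (L P k) (rSet (S P))) →
    (∀ P → ∃[ k ] SpanIs (L P k) (tSet (S P))) →
    let open Construction S m L in
      (Σ (Fin ((FiniteField.q F + 1) * (FiniteField.q F ^ 3 ∸ 1) + 1) → XIndex) λ e →
          (∀ i j → i ≢ j → ¬ SameSpan (plane (e i)) (plane (e j)))
        × (∀ x → ∃[ i ] SameSpan (plane x) (plane (e i))))
    × (∀ x → IsGenerator (plane x))
    × (∀ x → DisjointFromΠ₁ (plane x))
    × (∀ x y → ¬ SameSpan (plane x) (plane y) → MeetInAtMostAPoint (plane x) (plane y))
mainTheorem8 F S m L good spread r-line t-line = enumeration , generator , disjoint , meet
  where open PlanesOfX.Properties F S m L good spread r-line t-line
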